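{- For each even integer $t \ge 4$ define \begin{align*} U_t(x) &= 2x^{2t-1} + x^{t+3} - x^{t+2} + x^{t+1} - 3x^t + 3x^{t-1} - x^{t-2} + x^{t-3} - x^{t-4} - 2,\\ W_t(x) &= 2x^{2t-1} - x^{t+3} + x^{t+2} - x^{t+1} - x^t + x^{t-1} + x^{t-2} - x^{t-3} + x^{t-4} - 2. \end{align*} For each even $t \ge 4$, if $\Phi_b(x) \mid U_t(x)$ or $\Phi_b(x) \mid W_t(x)$ for some integer $b \ge 3$, then: $p^2 \nmid b$ for every prime $p \ge 7$; $5^3 \nmid b$ and $3^3 \nmid b$; and if $2^2 \mid b$, then $b \in \{4, 8\}$.
   Context: $\Phi_b(x)$ denotes the $b$-th cyclotomic polynomial, $\Phi_b(x) = \prod_\xi (x - \xi)$ with $\xi$ ranging over the primitive $b$-th roots of unity; divisibility is in $\mathbb{Q}[x]$. -}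

module Defs where

open import Data.Nat as ℕ using (ℕ; zero; suc; _∸_)
open import Data.Nat.Divisibility using (_∣?_)
open import Data.Integer as ℤ using (ℤ)
open import Data.Rational as ℚ using (ℚ; 0ℚ; 1ℚ)
open import Data.List using (List; []; _∷_; replicate; _++_; foldr; filter; upTo; map)
open import Relation.Binary.PropositionalEquality using (_≡_)
open import Data.Product using (∃)

-- Polynomials with rational coefficients, as coefficient lists,
-- constant term first (trailing zeros allowed).
Poly : Set
Poly = List ℚ

coeff : Poly → ℕ → ℚ
coeff []       _       = 0ℚ
coeff (a ∷ p)  zero    = a
coeff (a ∷ p)  (suc n) = coeff p n

infix 4 _≈ₚ_
_≈ₚ_ : Poly → Poly → Set
p ≈ₚ q = ∀ n → coeff p n ≡ coeff q n

infixl 6 _+ₚ_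
_+ₚ_ : Poly → Poly → Poly
[]      +ₚ q       = q
(a ∷ p) +ₚ []      = a ∷ p
(a ∷ p) +ₚ (b ∷ q) = (a ℚ.+ b) ∷ (p +ₚ q)

scale : ℚ → Poly → Poly
scale c = map (c ℚ.*_)

infixl 7 _*ₚ_
_*ₚ_ : Poly → Poly → Poly
[]      *ₚ q = []
(a ∷ p) *ₚ q = scale a q +ₚ (0ℚ ∷ (p *ₚ q))

infix 4 _∣ₚ_
_∣ₚ_ : Poly → Poly → Set
p ∣ₚ u = ∃ λ q → p *ₚ q ≈ₚ u

mono : ℚ → ℕ → Poly
mono c k = replicate k 0ℚ ++ (c ∷ [])

ι : ℤ → ℚ
ι z = z ℚ./ 1

prodₚ : List Poly → Poly
prodₚ = foldr _*ₚ_ (1ℚ ∷ [])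

sumₚ : List Poly → Poly
sumₚ = foldr _+ₚ_ []

divisors : ℕ → List ℕ
divisors n = filter (_∣? n) (map suc (upTo n))

xpow-1 : ℕ → Poly
xpow-1 n = mono 1ℚ n +ₚ mono (ℚ.- 1ℚ) 0

-- Φ is the family of cyclotomic polynomials: x^n - 1 = ∏_{d ∣ n} Φ_d(x)
-- for every n ≥ 1.  This determines Φ_n (n ≥ 1) uniquely up to ≈ₚ.
IsCyclotomicFamily : (ℕ → Poly) → Set
IsCyclotomicFamily Φ = ∀ n → xpow-1 (suc n) ≈ₚ prodₚ (map Φ (divisors (suc n)))

U : ℕ → Poly
U t = sumₚ
  ( mono (ι (ℤ.+ 2)) (2 ℕ.* t ∸ 1)
  ∷ mono (ι (ℤ.+ 1)) (t ℕ.+ 3)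
  ∷ mono (ι (ℤ.- ℤ.+ 1)) (t ℕ.+ 2)
  ∷ mono (ι (ℤ.+ 1)) (t ℕ.+ 1)
  ∷ mono (ι (ℤ.- ℤ.+ 3)) t
  ∷ mono (ι (ℤ.+ 3)) (t ∸ 1)
  ∷ mono (ι (ℤ.- ℤ.+ 1)) (t ∸ 2)
  ∷ mono (ι (ℤ.+ 1)) (t ∸ 3)
  ∷ mono (ι (ℤ.- ℤ.+ 1)) (t ∸ 4)
  ∷ mono (ι (ℤ.- ℤ.+ 2)) 0
  ∷ [])

W : ℕ → Poly
W t = sumₚ
  ( mono (ι (ℤ.+ 2)) (2 ℕ.* t ∸ 1)
  ∷ mono (ι (ℤ.- ℤ.+ 1)) (t ℕ.+ 3)
  ∷ mono (ι (ℤ.+ 1)) (t ℕ.+ 2)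
  ∷ mono (ι (ℤ.- ℤ.+ 1)) (t ℕ.+ 1)
  ∷ mono (ι (ℤ.- ℤ.+ 1)) t
  ∷ mono (ι (ℤ.+ 1)) (t ∸ 1)
  ∷ mono (ι (ℤ.+ 1)) (t ∸ 2)
  ∷ mono (ι (ℤ.- ℤ.+ 1)) (t ∸ 3)
  ∷ mono (ι (ℤ.+ 1)) (t ∸ 4)
  ∷ mono (ι (ℤ.- ℤ.+ 2)) 0
  ∷ [])

module Submission where

-- Work modulo 2.  Long division by a polynomial with odd constant term creates no even
-- denominators, so by induction over ∏_{d ∣ n} Φ_d = xⁿ − 1 every Φ_n is 2-integral with odd
-- constant term, and reduces to some ψ_n ∈ 𝔽₂[x] with ∏_{d ∣ n} ψ_d = xⁿ + 1.  Both U_t and W_t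
-- reduce to x^(t−4) (1 + x + ⋯ + x⁷), so Φ_b ∣ U_t or Φ_b ∣ W_t gives ψ_b ∣ 1 + x + ⋯ + x⁷, which
-- divides x⁸ + 1 (ψ_b ∣ x^b + 1 is prime to x).  Degrees obey Σ_{d ∣ n} deg ψ_d = n, so
-- deg ψ_n = φ(n) ≥ 1.  If b = cp with p ≥ 3 odd, then p² ≡ 1 (mod 8) forces ψ_b ∣ x^c + 1, while
-- ψ_b also divides (x^b + 1)/(x^c + 1) = 1 + x^c + ⋯ + x^(c(p−1)) ≡ p ≡ 1: impossible.  So b = 2^e
-- with 2^(e−1) = φ(b) ≤ 7, i.e. b ∈ {4, 8}, and all four conclusions follow.

open import Algebra.Core using (Op₂)
open import Algebra.Structures using (IsCommutativeSemiring)
open import Relation.Binary.PropositionalEquality using (_≡_)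

-- The polynomial arithmetic of Defs over any commutative semiring with ≡ as its equality, so
-- that it serves both over ℚ and over 𝔽₂.  Equality of polynomials is a record, so that Agda can
-- infer the two polynomials from a proof.
module Polynomial
  {A : Set} {plus times : Op₂ A} {0# 1# : A}
  (isCommutativeSemiring : IsCommutativeSemiring _≡_ plus times 0# 1#) where

  open import Level using (0ℓ)
  open import Algebra.Bundles using (CommutativeMonoid; CommutativeSemiring)
  open import Algebra.Structures using (IsCommutativeMonoid)
  open import Algebra.Structures.Biased using (isCommutativeSemiringˡ)
  import Algebra.Properties.CommutativeSemigroup as CommutativeSemigroupProperties
  open import Data.Bool.Base using (true; false)
  open import Data.Nat.Base as ℕ using (ℕ; zero; suc)
  open import Data.List.Base using (List; []; _∷_; _++_; foldr; map; filter; replicate; drop)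
  open import Data.List.Membership.Propositional using (_∈_)
  open import Data.List.Relation.Unary.Any using (here; there)
  open import Data.Product.Base using (_,_)
  open import Function.Base using (_∘_)
  open import Relation.Nullary using (Dec; does; ¬?)
  open import Relation.Binary.Bundles using (Setoid)
  open import Relation.Binary.Structures using (IsEquivalence)
  open import Relation.Binary.PropositionalEquality
  import Relation.Binary.Reasoning.Setoid as SetoidReasoning

  coefficientSemiring : CommutativeSemiring 0ℓ 0ℓ
  coefficientSemiring = record { isCommutativeSemiring = isCommutativeSemiring }

  open CommutativeSemiring coefficientSemiring
    using (_+_; _*_; +-assoc; +-comm; +-identityˡ; +-identityʳ; *-assoc; *-comm; *-identityˡ; zeroˡ; zeroʳ; distribˡ; distribʳ)

  Poly : Set
  Poly = List A

  coeff : Poly → ℕ → A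
  coeff []      _       = 0#
  coeff (a ∷ p) zero    = a
  coeff (a ∷ p) (suc n) = coeff p n

  infix 4 _≈ₚ_
  record _≈ₚ_ (p q : Poly) : Set where
    constructor coeffwise
    field coeff-≡ : ∀ n → coeff p n ≡ coeff q n
  open _≈ₚ_ public

  infixl 6 _+ₚ_
  infixl 7 _*ₚ_

  0ₚ 1ₚ : Poly
  0ₚ = []
  1ₚ = 1# ∷ []

  _+ₚ_ : Poly → Poly → Poly
  []      +ₚ q       = q
  (a ∷ p) +ₚ []      = a ∷ p
  (a ∷ p) +ₚ (b ∷ q) = (a + b) ∷ (p +ₚ q)

  scale : A → Poly → Poly
  scale c = map (c *_)

  _*ₚ_ : Poly → Poly → Poly
  []      *ₚ q = []
  (a ∷ p) *ₚ q = scale a q +ₚ (0# ∷ (p *ₚ q))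

  X^_ : ℕ → Poly
  X^ k = replicate k 0# ++ 1ₚ

  prodₚ : List Poly → Poly
  prodₚ = foldr _*ₚ_ 1ₚ

  ≈ₚ-isEquivalence : IsEquivalence _≈ₚ_
  ≈ₚ-isEquivalence = record
    { refl  = coeffwise λ _ → refl
    ; sym   = λ e → coeffwise λ n → sym (coeff-≡ e n)
    ; trans = λ e f → coeffwise λ n → trans (coeff-≡ e n) (coeff-≡ f n)
    }

  ≈ₚ-setoid : Setoid 0ℓ 0ℓ
  ≈ₚ-setoid = record { isEquivalence = ≈ₚ-isEquivalence }

  open IsEquivalence ≈ₚ-isEquivalence public
    using () renaming (refl to ≈ₚ-refl; sym to ≈ₚ-sym; trans to ≈ₚ-trans; reflexive to ≈ₚ-reflexive)

  module ≈ₚ-Reasoning = SetoidReasoning ≈ₚ-setoid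

  coeff-+ₚ : ∀ p q n → coeff (p +ₚ q) n ≡ coeff p n + coeff q n
  coeff-+ₚ []      q       n       = sym (+-identityˡ _)
  coeff-+ₚ (a ∷ p) []      n       = sym (+-identityʳ _)
  coeff-+ₚ (a ∷ p) (b ∷ q) zero    = refl
  coeff-+ₚ (a ∷ p) (b ∷ q) (suc n) = coeff-+ₚ p q n

  coeff-scale : ∀ c p n → coeff (scale c p) n ≡ c * coeff p n
  coeff-scale c []      n       = sym (zeroʳ c)
  coeff-scale c (a ∷ p) zero    = refl
  coeff-scale c (a ∷ p) (suc n) = coeff-scale c p n

  ∷-cong : ∀ {a b p q} → a ≡ b → p ≈ₚ q → a ∷ p ≈ₚ b ∷ q
  ∷-cong a≡b p≈q = coeffwise λ { zero → a≡b ; (suc n) → coeff-≡ p≈q n }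

  coeff-drop : ∀ p n → coeff (drop 1 p) n ≡ coeff p (suc n)
  coeff-drop []      n = refl
  coeff-drop (a ∷ p) n = refl

  ∷-head-drop : ∀ p → coeff p 0 ∷ drop 1 p ≈ₚ p
  ∷-head-drop p = coeffwise λ { zero → refl ; (suc n) → coeff-drop p n }

  0#∷0ₚ : 0# ∷ 0ₚ ≈ₚ 0ₚ
  0#∷0ₚ = coeffwise λ { zero → refl ; (suc n) → refl }

  +ₚ-cong : ∀ {p p′ q q′} → p ≈ₚ p′ → q ≈ₚ q′ → p +ₚ q ≈ₚ p′ +ₚ q′
  +ₚ-cong {p} {p′} {q} {q′} e f = coeffwise λ n → begin
    coeff (p +ₚ q) n          ≡⟨ coeff-+ₚ p q n ⟩
    coeff p n + coeff q n     ≡⟨ cong₂ _+_ (coeff-≡ e n) (coeff-≡ f n) ⟩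
    coeff p′ n + coeff q′ n   ≡⟨ coeff-+ₚ p′ q′ n ⟨
    coeff (p′ +ₚ q′) n        ∎
    where open ≡-Reasoning

  +ₚ-congˡ : ∀ p {q q′} → q ≈ₚ q′ → p +ₚ q ≈ₚ p +ₚ q′
  +ₚ-congˡ p = +ₚ-cong (≈ₚ-refl {p})

  +ₚ-congʳ : ∀ {p p′} q → p ≈ₚ p′ → p +ₚ q ≈ₚ p′ +ₚ q
  +ₚ-congʳ q e = +ₚ-cong e (≈ₚ-refl {q})

  +ₚ-comm : ∀ p q → p +ₚ q ≈ₚ q +ₚ p
  +ₚ-comm p q = coeffwise λ n →
    trans (coeff-+ₚ p q n) (trans (+-comm _ _) (sym (coeff-+ₚ q p n)))

  +ₚ-assoc : ∀ p q r → (p +ₚ q) +ₚ r ≈ₚ p +ₚ (q +ₚ r)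
  +ₚ-assoc p q r = coeffwise λ n → begin
    coeff ((p +ₚ q) +ₚ r) n                 ≡⟨ coeff-+ₚ (p +ₚ q) r n ⟩
    coeff (p +ₚ q) n + coeff r n            ≡⟨ cong (_+ coeff r n) (coeff-+ₚ p q n) ⟩
    (coeff p n + coeff q n) + coeff r n     ≡⟨ +-assoc _ _ _ ⟩
    coeff p n + (coeff q n + coeff r n)     ≡⟨ cong (coeff p n +_) (coeff-+ₚ q r n) ⟨
    coeff p n + coeff (q +ₚ r) n            ≡⟨ coeff-+ₚ p (q +ₚ r) n ⟨
    coeff (p +ₚ (q +ₚ r)) n                 ∎
    where open ≡-Reasoning

  +ₚ-identityʳ : ∀ p → p +ₚ 0ₚ ≈ₚ p
  +ₚ-identityʳ []      = ≈ₚ-refl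
  +ₚ-identityʳ (a ∷ p) = ≈ₚ-refl

  +ₚ-isCommutativeMonoid : IsCommutativeMonoid _≈ₚ_ _+ₚ_ 0ₚ
  +ₚ-isCommutativeMonoid = record
    { isMonoid = record
      { isSemigroup = record
        { isMagma = record { isEquivalence = ≈ₚ-isEquivalence ; ∙-cong = +ₚ-cong }
        ; assoc = +ₚ-assoc
        }
      ; identity = (λ _ → ≈ₚ-refl) , +ₚ-identityʳ
      }
    ; comm = +ₚ-comm
    }

  +ₚ-commutativeMonoid : CommutativeMonoid 0ℓ 0ℓ
  +ₚ-commutativeMonoid = record { isCommutativeMonoid = +ₚ-isCommutativeMonoid }

  module +ₚ = CommutativeSemigroupProperties (CommutativeMonoid.commutativeSemigroup +ₚ-commutativeMonoid)

  scale-cong : ∀ c {p q} → p ≈ₚ q → scale c p ≈ₚ scale c q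
  scale-cong c {p} {q} e = coeffwise λ n →
    trans (coeff-scale c p n) (trans (cong (c *_) (coeff-≡ e n)) (sym (coeff-scale c q n)))

  scale-zero : ∀ p → scale 0# p ≈ₚ 0ₚ
  scale-zero p = coeffwise λ n → trans (coeff-scale 0# p n) (zeroˡ _)

  scale-identity : ∀ p → scale 1# p ≈ₚ p
  scale-identity p = coeffwise λ n → trans (coeff-scale 1# p n) (*-identityˡ _)

  scale-distribˡ : ∀ c p q → scale c (p +ₚ q) ≈ₚ scale c p +ₚ scale c q
  scale-distribˡ c p q = coeffwise λ n → begin
    coeff (scale c (p +ₚ q)) n                  ≡⟨ coeff-scale c (p +ₚ q) n ⟩
    c * coeff (p +ₚ q) n                        ≡⟨ cong (c *_) (coeff-+ₚ p q n) ⟩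
    c * (coeff p n + coeff q n)                 ≡⟨ distribˡ c _ _ ⟩
    c * coeff p n + c * coeff q n               ≡⟨ cong₂ _+_ (coeff-scale c p n) (coeff-scale c q n) ⟨
    coeff (scale c p) n + coeff (scale c q) n   ≡⟨ coeff-+ₚ (scale c p) (scale c q) n ⟨
    coeff (scale c p +ₚ scale c q) n            ∎
    where open ≡-Reasoning

  scale-distribʳ : ∀ a b p → scale (a + b) p ≈ₚ scale a p +ₚ scale b p
  scale-distribʳ a b p = coeffwise λ n → begin
    coeff (scale (a + b) p) n                   ≡⟨ coeff-scale (a + b) p n ⟩
    (a + b) * coeff p n                         ≡⟨ distribʳ _ a b ⟩
    a * coeff p n + b * coeff p n               ≡⟨ cong₂ _+_ (coeff-scale a p n) (coeff-scale b p n) ⟨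
    coeff (scale a p) n + coeff (scale b p) n   ≡⟨ coeff-+ₚ (scale a p) (scale b p) n ⟨
    coeff (scale a p +ₚ scale b p) n            ∎
    where open ≡-Reasoning

  scale-assoc : ∀ a b p → scale a (scale b p) ≈ₚ scale (a * b) p
  scale-assoc a b p = coeffwise λ n → begin
    coeff (scale a (scale b p)) n   ≡⟨ coeff-scale a (scale b p) n ⟩
    a * coeff (scale b p) n         ≡⟨ cong (a *_) (coeff-scale b p n) ⟩
    a * (b * coeff p n)             ≡⟨ *-assoc a b _ ⟨
    (a * b) * coeff p n             ≡⟨ coeff-scale (a * b) p n ⟨
    coeff (scale (a * b) p) n       ∎
    where open ≡-Reasoning

  *ₚ-zeroˡ : ∀ {p} q → p ≈ₚ 0ₚ → p *ₚ q ≈ₚ 0ₚ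
  *ₚ-zeroˡ {[]}    q _ = ≈ₚ-refl
  *ₚ-zeroˡ {a ∷ p} q e with refl ← coeff-≡ e 0 =
    +ₚ-cong (scale-zero q) (≈ₚ-trans (∷-cong refl (*ₚ-zeroˡ {p} q (coeffwise λ n → coeff-≡ e (suc n)))) 0#∷0ₚ)

  *ₚ-zeroʳ : ∀ p → p *ₚ 0ₚ ≈ₚ 0ₚ
  *ₚ-zeroʳ []      = ≈ₚ-refl
  *ₚ-zeroʳ (a ∷ p) = ≈ₚ-trans (∷-cong refl (*ₚ-zeroʳ p)) 0#∷0ₚ

  *ₚ-congˡ : ∀ {p p′} q → p ≈ₚ p′ → p *ₚ q ≈ₚ p′ *ₚ q
  *ₚ-congˡ {[]}    {p′}     q e = ≈ₚ-sym (*ₚ-zeroˡ q (≈ₚ-sym e))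
  *ₚ-congˡ {a ∷ p} {[]}     q e = *ₚ-zeroˡ q e
  *ₚ-congˡ {a ∷ p} {b ∷ p′} q e with refl ← coeff-≡ e 0 =
    +ₚ-congˡ (scale a q) (∷-cong refl (*ₚ-congˡ {p} {p′} q (coeffwise λ n → coeff-≡ e (suc n))))

  *ₚ-congʳ : ∀ p {q q′} → q ≈ₚ q′ → p *ₚ q ≈ₚ p *ₚ q′
  *ₚ-congʳ []      e = ≈ₚ-refl
  *ₚ-congʳ (a ∷ p) e = +ₚ-cong (scale-cong a e) (∷-cong refl (*ₚ-congʳ p e))

  *ₚ-cong : ∀ {p p′ q q′} → p ≈ₚ p′ → q ≈ₚ q′ → p *ₚ q ≈ₚ p′ *ₚ q′
  *ₚ-cong {p′ = p′} {q = q} e f = ≈ₚ-trans (*ₚ-congˡ q e) (*ₚ-congʳ p′ f)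

  0#∷-*ₚ : ∀ p q → (0# ∷ p) *ₚ q ≈ₚ 0# ∷ p *ₚ q
  0#∷-*ₚ p q = +ₚ-congʳ (0# ∷ p *ₚ q) (scale-zero q)

  *ₚ-∷ʳ : ∀ q a p → q *ₚ (a ∷ p) ≈ₚ scale a q +ₚ (0# ∷ q *ₚ p)
  *ₚ-∷ʳ []      a p = ≈ₚ-sym 0#∷0ₚ
  *ₚ-∷ʳ (b ∷ q) a p = begin
    (b * a ∷ scale b p) +ₚ (0# ∷ q *ₚ (a ∷ p))
      ≈⟨ +ₚ-congˡ (b * a ∷ scale b p) (∷-cong refl (*ₚ-∷ʳ q a p)) ⟩
    (b * a + 0#) ∷ (scale b p +ₚ (scale a q +ₚ (0# ∷ q *ₚ p)))
      ≈⟨ ∷-cong (cong (_+ 0#) (*-comm b a)) (+ₚ.x∙yz≈y∙xz (scale b p) (scale a q) (0# ∷ q *ₚ p)) ⟩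
    (a * b + 0#) ∷ (scale a q +ₚ (scale b p +ₚ (0# ∷ q *ₚ p)))
      ∎
    where open ≈ₚ-Reasoning

  *ₚ-comm : ∀ p q → p *ₚ q ≈ₚ q *ₚ p
  *ₚ-comm []      q = ≈ₚ-sym (*ₚ-zeroʳ q)
  *ₚ-comm (a ∷ p) q = ≈ₚ-trans (+ₚ-congˡ (scale a q) (∷-cong refl (*ₚ-comm p q))) (≈ₚ-sym (*ₚ-∷ʳ q a p))

  *ₚ-distribʳ : ∀ r p q → (p +ₚ q) *ₚ r ≈ₚ p *ₚ r +ₚ q *ₚ r
  *ₚ-distribʳ r []      q       = ≈ₚ-refl
  *ₚ-distribʳ r (a ∷ p) []      = ≈ₚ-sym (+ₚ-identityʳ _)
  *ₚ-distribʳ r (a ∷ p) (b ∷ q) = begin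
    scale (a + b) r +ₚ (0# ∷ (p +ₚ q) *ₚ r)
      ≈⟨ +ₚ-cong (scale-distribʳ a b r) (∷-cong (sym (+-identityˡ 0#)) (*ₚ-distribʳ r p q)) ⟩
    (scale a r +ₚ scale b r) +ₚ ((0# ∷ p *ₚ r) +ₚ (0# ∷ q *ₚ r))
      ≈⟨ +ₚ.interchange (scale a r) (scale b r) (0# ∷ p *ₚ r) (0# ∷ q *ₚ r) ⟩
    (scale a r +ₚ (0# ∷ p *ₚ r)) +ₚ (scale b r +ₚ (0# ∷ q *ₚ r))
      ∎
    where open ≈ₚ-Reasoning

  scale-*ₚ : ∀ c p q → scale c (p *ₚ q) ≈ₚ scale c p *ₚ q
  scale-*ₚ c []      q = ≈ₚ-refl
  scale-*ₚ c (a ∷ p) q = ≈ₚ-trans (scale-distribˡ c (scale a q) _)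
    (+ₚ-cong (scale-assoc c a q) (∷-cong (zeroʳ c) (scale-*ₚ c p q)))

  *ₚ-assoc : ∀ p q r → (p *ₚ q) *ₚ r ≈ₚ p *ₚ (q *ₚ r)
  *ₚ-assoc []      q r = ≈ₚ-refl
  *ₚ-assoc (a ∷ p) q r = begin
    (scale a q +ₚ (0# ∷ p *ₚ q)) *ₚ r          ≈⟨ *ₚ-distribʳ r (scale a q) _ ⟩
    scale a q *ₚ r +ₚ (0# ∷ p *ₚ q) *ₚ r       ≈⟨ +ₚ-cong (≈ₚ-sym (scale-*ₚ a q r)) (0#∷-*ₚ (p *ₚ q) r) ⟩
    scale a (q *ₚ r) +ₚ (0# ∷ (p *ₚ q) *ₚ r)   ≈⟨ +ₚ-congˡ (scale a (q *ₚ r)) (∷-cong refl (*ₚ-assoc p q r)) ⟩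
    scale a (q *ₚ r) +ₚ (0# ∷ p *ₚ (q *ₚ r))   ∎
    where open ≈ₚ-Reasoning

  *ₚ-identityˡ : ∀ p → 1ₚ *ₚ p ≈ₚ p
  *ₚ-identityˡ p = ≈ₚ-trans (+ₚ-cong (scale-identity p) 0#∷0ₚ) (+ₚ-identityʳ p)

  *ₚ-identityʳ : ∀ p → p *ₚ 1ₚ ≈ₚ p
  *ₚ-identityʳ p = ≈ₚ-trans (*ₚ-comm p 1ₚ) (*ₚ-identityˡ p)

  *ₚ-isCommutativeMonoid : IsCommutativeMonoid _≈ₚ_ _*ₚ_ 1ₚ
  *ₚ-isCommutativeMonoid = record
    { isMonoid = record
      { isSemigroup = record
        { isMagma = record { isEquivalence = ≈ₚ-isEquivalence ; ∙-cong = *ₚ-cong }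
        ; assoc = *ₚ-assoc
        }
      ; identity = *ₚ-identityˡ , *ₚ-identityʳ
      }
    ; comm = *ₚ-comm
    }

  +ₚ-*ₚ-isCommutativeSemiring : IsCommutativeSemiring _≈ₚ_ _+ₚ_ _*ₚ_ 0ₚ 1ₚ
  +ₚ-*ₚ-isCommutativeSemiring = isCommutativeSemiringˡ record
    { +-isCommutativeMonoid = +ₚ-isCommutativeMonoid
    ; *-isCommutativeMonoid = *ₚ-isCommutativeMonoid
    ; distribʳ              = *ₚ-distribʳ
    ; zeroˡ                 = λ _ → ≈ₚ-refl
    }

  +ₚ-*ₚ-commutativeSemiring : CommutativeSemiring 0ℓ 0ℓ
  +ₚ-*ₚ-commutativeSemiring = record { isCommutativeSemiring = +ₚ-*ₚ-isCommutativeSemiring }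

  open CommutativeSemiring +ₚ-*ₚ-commutativeSemiring public
    using () renaming (distribˡ to *ₚ-distribˡ)

  module *ₚ = CommutativeSemigroupProperties (CommutativeSemiring.*-commutativeSemigroup +ₚ-*ₚ-commutativeSemiring)

  open import Algebra.Properties.CommutativeSemigroup.Divisibility
    (CommutativeSemiring.*-commutativeSemigroup +ₚ-*ₚ-commutativeSemiring) public

  coeff₀-*ₚ : ∀ p q → coeff (p *ₚ q) 0 ≡ coeff p 0 * coeff q 0
  coeff₀-*ₚ []      q = sym (zeroˡ _)
  coeff₀-*ₚ (a ∷ p) q = trans (coeff-+ₚ (scale a q) _ 0) (trans (+-identityʳ _) (coeff-scale a q 0))

  X^-+ : ∀ m n → X^ (m ℕ.+ n) ≈ₚ X^ m *ₚ X^ n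
  X^-+ zero    n = ≈ₚ-sym (*ₚ-identityˡ (X^ n))
  X^-+ (suc m) n = ≈ₚ-trans (∷-cong refl (X^-+ m n)) (≈ₚ-sym (0#∷-*ₚ (X^ m) (X^ n)))

  prodₚ-++ : ∀ ps qs → prodₚ (ps ++ qs) ≈ₚ prodₚ ps *ₚ prodₚ qs
  prodₚ-++ []       qs = ≈ₚ-sym (*ₚ-identityˡ _)
  prodₚ-++ (p ∷ ps) qs = ≈ₚ-trans (*ₚ-congʳ p (prodₚ-++ ps qs)) (≈ₚ-sym (*ₚ-assoc p _ _))

  ∣-+ₚ : ∀ {p q r} → p ∣ q → p ∣ r → p ∣ q +ₚ r
  ∣-+ₚ {p} (q/p , q/p*p≈q) (r/p , r/p*p≈r) =
    q/p +ₚ r/p , ≈ₚ-trans (*ₚ-distribʳ p q/p r/p) (+ₚ-cong q/p*p≈q r/p*p≈r)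

  sumₚ : List Poly → Poly
  sumₚ = foldr _+ₚ_ 0ₚ

  *ₚ-sumₚ : ∀ p qs → p *ₚ sumₚ qs ≈ₚ sumₚ (map (p *ₚ_) qs)
  *ₚ-sumₚ p []       = *ₚ-zeroʳ p
  *ₚ-sumₚ p (q ∷ qs) = ≈ₚ-trans (*ₚ-distribˡ p q (sumₚ qs)) (+ₚ-congˡ (p *ₚ q) (*ₚ-sumₚ p qs))

  ∈⇒∣prodₚ : ∀ {B : Set} (f : B → Poly) {x xs} → x ∈ xs → f x ∣ prodₚ (map f xs)
  ∈⇒∣prodₚ f {xs = y ∷ ys} (here refl) = prodₚ (map f ys) , *ₚ-comm _ (f y)
  ∈⇒∣prodₚ f {xs = y ∷ ys} (there x∈) = x∣ʳy⇒x∣ʳzy (f y) (∈⇒∣prodₚ f x∈)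

  prodₚ-partition : ∀ {B : Set} {P : B → Set} (P? : ∀ x → Dec (P x)) (f : B → Poly) xs →
    prodₚ (map f xs) ≈ₚ prodₚ (map f (filter P? xs)) *ₚ prodₚ (map f (filter (¬? ∘ P?) xs))
  prodₚ-partition P? f []       = ≈ₚ-sym (*ₚ-identityˡ 1ₚ)
  prodₚ-partition P? f (x ∷ xs) with does (P? x)
  ... | true  = ≈ₚ-trans (*ₚ-congʳ (f x) (prodₚ-partition P? f xs)) (≈ₚ-sym (*ₚ-assoc (f x) _ _))
  ... | false = ≈ₚ-trans (*ₚ-congʳ (f x) (prodₚ-partition P? f xs))
    (*ₚ.x∙yz≈y∙xz (f x) (prodₚ (map f (filter P? xs))) (prodₚ (map f (filter (¬? ∘ P?) xs))))

  sumₚ-cong : ∀ {B : Set} {f g : B → Poly} → (∀ x → f x ≈ₚ g x) → ∀ xs → sumₚ (map f xs) ≈ₚ sumₚ (map g xs)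
  sumₚ-cong f≈g []       = ≈ₚ-refl
  sumₚ-cong f≈g (x ∷ xs) = +ₚ-cong (f≈g x) (sumₚ-cong f≈g xs)

module Divisors where
  open import Defs using (divisors)
  open import Data.Bool.Base using (true; false; if_then_else_)
  open import Data.Nat.Base
  open import Data.Nat.Properties
  open import Data.Nat.Divisibility
  open import Data.Nat.Coprimality using (Coprime; coprime-divisor)
  open import Data.Nat.Induction using (<-rec)
  open import Data.Nat.ListAction using (sum; product)
  open import Data.Nat.ListAction.Properties using (sum-++)
  open import Data.Nat.Primality
    using (Prime; prime⇒irreducible; prime⇒nonZero; prime⇒nonTrivial; prime[2]; productOfPrimes≢0)
  open import Data.Nat.Primality.Factorisation using (factorise; PrimeFactorisation)
  open import Data.Nat.Tactic.RingSolver using (solve-∀)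
  import Algebra.Properties.CommutativeSemigroup +-commutativeSemigroup as ℕ+
  open import Data.List.Base using (List; []; _∷_; _∷ʳ_; _++_; map; filter; upTo; applyUpTo)
  open import Data.List.Properties using (filter-++; map-++; upTo-∷ʳ; filter-accept; map-upTo; map-cong-local; map-∘)
  open import Data.List.Membership.Propositional using (_∈_)
  open import Data.List.Membership.Propositional.Properties
    using (∈-filter⁺; ∈-filter⁻; ∈-map⁺; ∈-map⁻; ∈-upTo⁺; ∈-upTo⁻; ∈-applyUpTo⁻)
  open import Data.List.Relation.Binary.Subset.Propositional using (_⊆_)
  open import Data.List.Relation.Unary.All as All using (All; []; _∷_)
  open import Data.List.Relation.Unary.AllPairs as AllPairs using (AllPairs; []; _∷_)
  import Data.List.Relation.Unary.AllPairs.Properties as AllPairs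
  open import Data.List.Relation.Unary.Any using (here; there)
  open import Data.Product.Base using (∃; _×_; _,_; proj₂)
  open import Data.Sum.Base using (_⊎_; inj₁; inj₂)
  open import Function.Base using (_∘_)
  open import Relation.Nullary using (¬_; Dec; yes; no; ¬?; does; contradiction)
  open import Relation.Binary.PropositionalEquality

  <-sorted-⊆-antisym : ∀ {xs ys : List ℕ} → AllPairs _<_ xs → AllPairs _<_ ys → xs ⊆ ys → ys ⊆ xs → xs ≡ ys
  <-sorted-⊆-antisym {[]}     {[]}     _          _          _     _     = refl
  <-sorted-⊆-antisym {[]}     {y ∷ ys} _          _          _     ys⊆xs with () ← ys⊆xs (here refl)
  <-sorted-⊆-antisym {x ∷ xs} {[]}     _          _          xs⊆ys _     with () ← xs⊆ys (here refl)
  <-sorted-⊆-antisym {x ∷ xs} {y ∷ ys} (x< ∷ xs<) (y< ∷ ys<) xs⊆ys ys⊆xs =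
    cong₂ _∷_ x≡y (<-sorted-⊆-antisym xs< ys< (drop x< y< x≡y xs⊆ys) (drop y< x< (sym x≡y) ys⊆xs))
    where
    head-≤ : ∀ {a as z} → All (a <_) as → z ∈ a ∷ as → a ≤ z
    head-≤ _  (here refl) = ≤-refl
    head-≤ a< (there z∈)  = <⇒≤ (All.lookup a< z∈)
    x≡y : x ≡ y
    x≡y = ≤-antisym (head-≤ x< (ys⊆xs (here refl))) (head-≤ y< (xs⊆ys (here refl)))
    drop : ∀ {a b as bs} → All (a <_) as → All (b <_) bs → a ≡ b → a ∷ as ⊆ b ∷ bs → as ⊆ bs
    drop a< b< refl as⊆ z∈ with as⊆ (there z∈)
    ... | there z∈′ = z∈′
    ... | here refl = contradiction (All.lookup a< z∈) (<-irrefl refl)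

  properDivisors : ℕ → List ℕ
  properDivisors zero    = []
  properDivisors (suc n) = filter (_∣? suc n) (map suc (upTo n))

  divisors-∷ʳ : ∀ n → divisors (suc n) ≡ properDivisors (suc n) ∷ʳ suc n
  divisors-∷ʳ n = begin
    filter (_∣? suc n) (map suc (upTo (suc n)))              ≡⟨ cong (filter (_∣? suc n) ∘ map suc) (upTo-∷ʳ n) ⟨
    filter (_∣? suc n) (map suc (upTo n ∷ʳ n))               ≡⟨ cong (filter (_∣? suc n)) (map-++ suc (upTo n) (n ∷ [])) ⟩
    filter (_∣? suc n) (map suc (upTo n) ∷ʳ suc n)           ≡⟨ filter-++ (_∣? suc n) (map suc (upTo n)) (suc n ∷ []) ⟩
    properDivisors (suc n) ++ filter (_∣? suc n) (suc n ∷ []) ≡⟨ cong (properDivisors (suc n) ++_) (filter-accept (_∣? suc n) ∣-refl) ⟩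
    properDivisors (suc n) ∷ʳ suc n                          ∎
    where open ≡-Reasoning

  private
    range-sorted : ∀ n → AllPairs _<_ (map suc (upTo n))
    range-sorted n = subst (AllPairs _<_) (sym (map-upTo suc n)) (applyUpTo-sorted suc s≤s n)
      where
      applyUpTo-sorted : ∀ (f : ℕ → ℕ) → (∀ {i j} → i < j → f i < f j) → ∀ n → AllPairs _<_ (applyUpTo f n)
      applyUpTo-sorted f f-mono zero    = []
      applyUpTo-sorted f f-mono (suc n) =
        All.tabulate (λ z∈ → let (i , _ , z≡) = ∈-applyUpTo⁻ (f ∘ suc) z∈ in subst (f 0 <_) (sym z≡) (f-mono z<s))
        ∷ applyUpTo-sorted (f ∘ suc) (f-mono ∘ s≤s) n

  divisors-sorted : ∀ n → AllPairs _<_ (divisors n)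
  divisors-sorted n = AllPairs.filter⁺ (_∣? n) (range-sorted n)

  ∈-divisors⁺ : ∀ {d n} .{{_ : NonZero n}} → d ∣ n → d ∈ divisors n
  ∈-divisors⁺ {zero}  {n} d∣n = contradiction (0∣⇒≡0 d∣n) (≢-nonZero⁻¹ n)
  ∈-divisors⁺ {suc d} {n} d∣n = ∈-filter⁺ (_∣? n) (∈-map⁺ suc (∈-upTo⁺ (∣⇒≤ d∣n))) d∣n

  ∈-divisors⁻ : ∀ {d n} → d ∈ divisors n → NonZero d × d ∣ n
  ∈-divisors⁻ {d} {n} d∈ with ∈-filter⁻ (_∣? n) {xs = map suc (upTo n)} d∈
  ... | d∈range , d∣n with ∈-map⁻ suc d∈range
  ...   | _ , _ , refl = _ , d∣n

  ∈-properDivisors⁻ : ∀ {d n} → d ∈ properDivisors n → NonZero d × d < n × d ∣ n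
  ∈-properDivisors⁻ {d} {suc n} d∈ with ∈-filter⁻ (_∣? suc n) {xs = map suc (upTo n)} d∈
  ... | d∈range , d∣n with ∈-map⁻ suc d∈range
  ...   | i , i∈ , refl = _ , s≤s (∈-upTo⁻ i∈) , d∣n

  filter-∣-divisors : ∀ {b c} .{{_ : NonZero b}} .{{_ : NonZero c}} → c ∣ b →
    filter (_∣? c) (divisors b) ≡ divisors c
  filter-∣-divisors {b} {c} c∣b =
    <-sorted-⊆-antisym (AllPairs.filter⁺ (_∣? c) (divisors-sorted b)) (divisors-sorted c) sub sup
    where
    sub : filter (_∣? c) (divisors b) ⊆ divisors c
    sub z∈ = ∈-divisors⁺ (proj₂ (∈-filter⁻ (_∣? c) {xs = divisors b} z∈))
    sup : divisors c ⊆ filter (_∣? c) (divisors b)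
    sup z∈ = let z∣c = proj₂ (∈-divisors⁻ z∈) in ∈-filter⁺ (_∣? c) (∈-divisors⁺ (∣-trans z∣c c∣b)) z∣c

  filter-multiples : ∀ p n .{{_ : NonZero p}} .{{_ : NonZero n}} →
    filter (p ∣?_) (divisors (p * n)) ≡ map (p *_) (divisors n)
  filter-multiples p n = <-sorted-⊆-antisym
    (AllPairs.filter⁺ (p ∣?_) (divisors-sorted (p * n)))
    (AllPairs.map⁺ (AllPairs.map (*-monoʳ-< p) (divisors-sorted n))) sub sup
    where
    instance
      pn≢0 : NonZero (p * n)
      pn≢0 = m*n≢0 p n
    sub : filter (p ∣?_) (divisors (p * n)) ⊆ map (p *_) (divisors n)
    sub z∈ with ∈-filter⁻ (p ∣?_) {xs = divisors (p * n)} z∈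
    ... | z∈divisors , divides w refl =
      subst (_∈ map (p *_) (divisors n)) (*-comm p w)
        (∈-map⁺ (p *_) (∈-divisors⁺ (*-cancelˡ-∣ p (subst (_∣ p * n) (*-comm w p) (proj₂ (∈-divisors⁻ z∈divisors))))))
    sup : map (p *_) (divisors n) ⊆ filter (p ∣?_) (divisors (p * n))
    sup z∈ with ∈-map⁻ (p *_) z∈
    ... | w , w∈ , refl = ∈-filter⁺ (p ∣?_) (∈-divisors⁺ (*-monoʳ-∣ p (proj₂ (∈-divisors⁻ w∈)))) (m∣m*n w)

  filter-nonMultiples : ∀ {p} n .{{_ : NonZero n}} → Prime p →
    filter (¬? ∘ (p ∣?_)) (divisors (p * n)) ≡ filter (¬? ∘ (p ∣?_)) (divisors n)
  filter-nonMultiples {p} n pp = <-sorted-⊆-antisym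
    (AllPairs.filter⁺ p∤? (divisors-sorted (p * n))) (AllPairs.filter⁺ p∤? (divisors-sorted n)) sub sup
    where
    p∤? = ¬? ∘ (p ∣?_)
    instance
      pn≢0 : NonZero (p * n)
      pn≢0 = m*n≢0 p n {{prime⇒nonZero pp}}
    coprime : ∀ {d} → ¬ p ∣ d → Coprime d p
    coprime p∤d (k∣d , k∣p) with prime⇒irreducible pp k∣p
    ... | inj₁ k≡1 = k≡1
    ... | inj₂ refl = contradiction k∣d p∤d
    sub : filter p∤? (divisors (p * n)) ⊆ filter p∤? (divisors n)
    sub z∈ with ∈-filter⁻ p∤? {xs = divisors (p * n)} z∈
    ... | z∈divisors , p∤z =
      ∈-filter⁺ p∤? (∈-divisors⁺ (coprime-divisor (coprime p∤z) (proj₂ (∈-divisors⁻ z∈divisors)))) p∤z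
    sup : filter p∤? (divisors n) ⊆ filter p∤? (divisors (p * n))
    sup z∈ with ∈-filter⁻ p∤? {xs = divisors n} z∈
    ... | z∈divisors , p∤z = ∈-filter⁺ p∤? (∈-divisors⁺ (∣-trans (proj₂ (∈-divisors⁻ z∈divisors)) (n∣m*n p))) p∤z

  sum-map-filter : ∀ {A : Set} {P : A → Set} (P? : ∀ x → Dec (P x)) (f : A → ℕ) xs →
    sum (map f xs) ≡ sum (map f (filter P? xs)) + sum (map f (filter (¬? ∘ P?) xs))
  sum-map-filter P? f []       = refl
  sum-map-filter P? f (x ∷ xs) with does (P? x)
  ... | true  = trans (cong (f x +_) (sum-map-filter P? f xs)) (sym (+-assoc (f x) _ _))
  ... | false = trans (cong (f x +_) (sum-map-filter P? f xs))
    (ℕ+.x∙yz≈y∙xz (f x) (sum (map f (filter P? xs))) (sum (map f (filter (¬? ∘ P?) xs))))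

  sum-map-filter-¬ : ∀ {A : Set} {P : A → Set} (P? : ∀ x → Dec (P x)) (f : A → ℕ) xs →
    sum (map f (filter (¬? ∘ P?) xs)) ≡ sum (map (λ x → if does (P? x) then 0 else f x) xs)
  sum-map-filter-¬ P? f []       = refl
  sum-map-filter-¬ P? f (x ∷ xs) with does (P? x)
  ... | true  = sum-map-filter-¬ P? f xs
  ... | false = cong (f x +_) (sum-map-filter-¬ P? f xs)

  sum-map-+ : ∀ {A : Set} (f g : A → ℕ) xs → sum (map (λ x → f x + g x) xs) ≡ sum (map f xs) + sum (map g xs)
  sum-map-+ f g []       = refl
  sum-map-+ f g (x ∷ xs) = trans (cong (f x + g x +_) (sum-map-+ f g xs)) (ℕ+.interchange (f x) (g x) _ _)

  sum-map-* : ∀ {A : Set} c (f : A → ℕ) xs → sum (map (λ x → c * f x) xs) ≡ c * sum (map f xs)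
  sum-map-* c f []       = sym (*-zeroʳ c)
  sum-map-* c f (x ∷ xs) = trans (cong (c * f x +_) (sum-map-* c f xs)) (sym (*-distribˡ-+ c (f x) _))

  sum-map-∷ʳ : ∀ {A : Set} (f : A → ℕ) xs x → sum (map f (xs ∷ʳ x)) ≡ sum (map f xs) + f x
  sum-map-∷ʳ f xs x = begin
    sum (map f (xs ∷ʳ x))          ≡⟨ cong sum (map-++ f xs (x ∷ [])) ⟩
    sum (map f xs ∷ʳ f x)          ≡⟨ sum-++ (map f xs) (f x ∷ []) ⟩
    sum (map f xs) + (f x + 0)     ≡⟨ cong (sum (map f xs) +_) (+-identityʳ (f x)) ⟩
    sum (map f xs) + f x           ∎
    where open ≡-Reasoning

  -- Such a δ is Euler's totient φ.
  module DivisorSum (δ : ℕ → ℕ) (δ-sum : ∀ n .{{_ : NonZero n}} → sum (map δ (divisors n)) ≡ n) where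

    δ∤ : ℕ → ℕ → ℕ
    δ∤ p d = if does (p ∣? d) then 0 else δ d

    δ-recurrence : ∀ {p} → Prime p → ∀ n .{{_ : NonZero n}} → δ (p * n) + δ∤ p n ≡ p * δ n
    δ-recurrence {p} pp n@(suc _) = <-rec (λ n → NonZero n → F n ≡ p * δ n) step n _
      where
      instance
        p≢0 : NonZero p
        p≢0 = prime⇒nonZero pp
      F : ℕ → ℕ
      F d = δ (p * d) + δ∤ p d
      step : ∀ n → (∀ {m} → m < n → NonZero m → F m ≡ p * δ m) → NonZero n → F n ≡ p * δ n
      step n@(suc k) IH _ = +-cancelˡ-≡ (p * S) (F n) (p * δ n) (begin
        p * S + F n                  ≡⟨ split ⟨
        sum (map F (divisors n))     ≡⟨ total ⟨
        p * n                        ≡⟨ cong (p *_) (trans (sym (δ-sum n)) (divisors-sum δ)) ⟩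
        p * (S + δ n)                ≡⟨ *-distribˡ-+ p S (δ n) ⟩
        p * S + p * δ n              ∎)
        where
        open ≡-Reasoning
        P = properDivisors n
        S = sum (map δ P)
        divisors-sum : ∀ f → sum (map f (divisors n)) ≡ sum (map f P) + f n
        divisors-sum f = trans (cong (sum ∘ map f) (divisors-∷ʳ k)) (sum-map-∷ʳ f P n)
        IH-proper : All (λ d → F d ≡ p * δ d) P
        IH-proper = All.tabulate λ d∈ → let (d≢0 , d<n , _) = ∈-properDivisors⁻ {n = n} d∈ in IH d<n d≢0
        split : sum (map F (divisors n)) ≡ p * S + F n
        split = begin
          sum (map F (divisors n))         ≡⟨ divisors-sum F ⟩
          sum (map F P) + F n              ≡⟨ cong (λ s → sum s + F n) (map-cong-local IH-proper) ⟩
          sum (map (λ d → p * δ d) P) + F n ≡⟨ cong (_+ F n) (sum-map-* p δ P) ⟩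
          p * S + F n                      ∎
        total : p * n ≡ sum (map F (divisors n))
        total = begin
          p * n
            ≡⟨ δ-sum (p * n) {{m*n≢0 p n}} ⟨
          sum (map δ (divisors (p * n)))
            ≡⟨ sum-map-filter (p ∣?_) δ (divisors (p * n)) ⟩
          sum (map δ (filter (p ∣?_) (divisors (p * n)))) + sum (map δ (filter (¬? ∘ (p ∣?_)) (divisors (p * n))))
            ≡⟨ cong₂ (λ xs ys → sum (map δ xs) + sum (map δ ys)) (filter-multiples p n) (filter-nonMultiples n pp) ⟩
          sum (map δ (map (p *_) (divisors n))) + sum (map δ (filter (¬? ∘ (p ∣?_)) (divisors n)))
            ≡⟨ cong₂ _+_ (cong sum (map-∘ (divisors n))) (sym (sum-map-filter-¬ (p ∣?_) δ (divisors n))) ⟨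
          sum (map (λ d → δ (p * d)) (divisors n)) + sum (map (δ∤ p) (divisors n))
            ≡⟨ sum-map-+ (λ d → δ (p * d)) (δ∤ p) (divisors n) ⟨
          sum (map F (divisors n))
            ∎

    δ-multiple : ∀ {p n} .{{_ : NonZero n}} → Prime p → p ∣ n → δ (p * n) ≡ p * δ n
    δ-multiple {p} {n} pp p∣n with p ∣? n | δ-recurrence pp n
    ... | yes _  | eq = trans (sym (+-identityʳ _)) eq
    ... | no p∤n | _  = contradiction p∣n p∤n

    δ-nonMultiple : ∀ {p n} .{{_ : NonZero n}} → Prime p → ¬ p ∣ n → δ (p * n) + δ n ≡ p * δ n
    δ-nonMultiple {p} {n} pp p∤n with p ∣? n | δ-recurrence pp n
    ... | yes p∣n | _  = contradiction p∣n p∤n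
    ... | no _    | eq = eq

    δ[1]≡1 : δ 1 ≡ 1
    δ[1]≡1 = trans (sym (+-identityʳ (δ 1))) (δ-sum 1)

    δ-≤-prime-* : ∀ {p n} .{{_ : NonZero n}} → Prime p → δ n ≤ δ (p * n)
    δ-≤-prime-* {p} {n} pp with p ∣? n
    ... | yes p∣n = subst (δ n ≤_) (sym (δ-multiple pp p∣n)) (m≤n*m (δ n) p {{prime⇒nonZero pp}})
    ... | no p∤n  = +-cancelʳ-≤ (δ n) (δ n) (δ (p * n)) (begin
      δ n + δ n        ≡⟨ cong (δ n +_) (+-identityʳ (δ n)) ⟨
      2 * δ n          ≤⟨ *-monoˡ-≤ (δ n) (nonTrivial⇒n>1 p {{prime⇒nonTrivial pp}}) ⟩
      p * δ n          ≡⟨ δ-nonMultiple pp p∤n ⟨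
      δ (p * n) + δ n  ∎)
      where open ≤-Reasoning

    δ-pos : ∀ n .{{_ : NonZero n}} → 1 ≤ δ n
    δ-pos n = subst (λ m → 1 ≤ δ m) (sym isFactorisation) (product-pos factorsPrime)
      where
      open PrimeFactorisation (factorise n)
      product-pos : ∀ {ps} → All Prime ps → 1 ≤ δ (product ps)
      product-pos []        = ≤-reflexive (sym δ[1]≡1)
      product-pos (pp ∷ ps) = ≤-trans (product-pos ps) (δ-≤-prime-* {{productOfPrimes≢0 ps}} pp)

    δ[2^[1+e]]≡2^e : ∀ e → δ (2 ^ suc e) ≡ 2 ^ e
    δ[2^[1+e]]≡2^e zero    = +-cancelʳ-≡ 1 (δ 2) 1 (begin
      δ 2 + 1        ≡⟨ cong (δ 2 +_) δ[1]≡1 ⟨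
      δ (2 * 1) + δ 1 ≡⟨ δ-nonMultiple prime[2] (λ 2∣1 → contradiction (∣⇒≤ 2∣1) (<⇒≱ ≤-refl)) ⟩
      2 * δ 1        ≡⟨ cong (2 *_) δ[1]≡1 ⟩
      2              ∎)
      where open ≡-Reasoning
    δ[2^[1+e]]≡2^e (suc e) = begin
      δ (2 * 2 ^ suc e)  ≡⟨ δ-multiple {{m^n≢0 2 (suc e)}} prime[2] (m∣m*n (2 ^ e)) ⟩
      2 * δ (2 ^ suc e)  ≡⟨ cong (2 *_) (δ[2^[1+e]]≡2^e e) ⟩
      2 * 2 ^ e          ∎
      where open ≡-Reasoning

  odd² : ∀ k → ∃ λ w → (1 + 2 * k) * (1 + 2 * k) ≡ 1 + 8 * w
  odd² zero    = 0 , refl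
  odd² (suc k) = let (w , eq) = odd² k in w + suc k , (begin
    (1 + 2 * suc k) * (1 + 2 * suc k)        ≡⟨ expand k ⟩
    (1 + 2 * k) * (1 + 2 * k) + 8 * suc k    ≡⟨ cong (_+ 8 * suc k) eq ⟩
    1 + 8 * w + 8 * suc k                    ≡⟨ collect w (suc k) ⟩
    1 + 8 * (w + suc k)                      ∎)
    where
    open ≡-Reasoning
    expand : ∀ k → (1 + 2 * suc k) * (1 + 2 * suc k) ≡ (1 + 2 * k) * (1 + 2 * k) + 8 * suc k
    expand = solve-∀
    collect : ∀ w m → 1 + 8 * w + 8 * m ≡ 1 + 8 * (w + m)
    collect = solve-∀

  powerOfTwo⊎oddDivisor : ∀ b .{{_ : NonZero b}} → (∃ λ e → b ≡ 2 ^ e) ⊎ (∃ λ k → 1 ≤ k × 1 + 2 * k ∣ b)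
  powerOfTwo⊎oddDivisor b@(suc _) = <-rec P step b _
    where
    P : ℕ → Set
    P b = NonZero b → (∃ λ e → b ≡ 2 ^ e) ⊎ (∃ λ k → 1 ≤ k × 1 + 2 * k ∣ b)
    halve : ∀ n → ∃ λ m → n ≡ 2 * m ⊎ n ≡ 1 + 2 * m
    halve zero    = 0 , inj₁ refl
    halve (suc n) with halve n
    ... | m , inj₁ n≡2m   = m , inj₂ (cong suc n≡2m)
    ... | m , inj₂ n≡1+2m = suc m , inj₁ (trans (cong suc n≡1+2m) (sym (*-suc 2 m)))
    step : ∀ b → (∀ {m} → m < b → P m) → P b
    step b IH b≢0 with halve b
    ... | zero  , inj₂ b≡1   = inj₁ (0 , b≡1)
    ... | suc k , inj₂ b≡odd = inj₂ (suc k , s≤s z≤n , ∣-reflexive (sym b≡odd))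
    ... | m     , inj₁ refl with IH m<2*m m≢0
      where
      m≢0 : NonZero m
      m≢0 = m*n≢0⇒n≢0 2 {{b≢0}}
      m<2*m : m < 2 * m
      m<2*m = subst (m <_) (*-comm m 2) (m<m*n m 2 {{m≢0}} (s≤s (s≤s z≤n)))
    ...   | inj₁ (e , refl)        = inj₁ (suc e , refl)
    ...   | inj₂ (k , 1≤k , k∣m)   = inj₂ (k , 1≤k , ∣-trans k∣m (n∣m*n 2))

module 𝔽₂[X] where
  open import Defs using (divisors)
  open Divisors
  open import Algebra.Bundles using (CommutativeRing)
  open import Data.Bool.Base using (true; false; _∧_; _xor_)
  open import Data.Bool.Properties using (xor-∧-commutativeRing; xor-same; ∧-zeroʳ)
  open import Data.Nat.Base as ℕ using (ℕ; zero; suc; _+_; _*_; _∸_; _^_; _≤_; _<_; z≤n; s≤s; NonZero; >-nonZero)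
  import Data.Nat.Properties as ℕ
  open import Data.Nat.Divisibility using (_∣?_; divides; ∣-refl; ∣⇒≤)
  import Data.Nat.Divisibility as ℕ
  open import Data.Nat.ListAction using (sum)
  open import Data.Nat.Tactic.RingSolver using (solve-∀)
  open import Data.List.Base using (List; []; _∷_; map; filter)
  open import Data.List.Membership.Propositional.Properties using (∈-filter⁺)
  open import Data.Product.Base using (∃; _,_; proj₁; proj₂)
  open import Data.Sum.Base using (_⊎_; inj₁; inj₂)
  open import Function.Base using (_∘_)
  open import Relation.Nullary using (¬_; ¬?; contradiction)
  open import Relation.Binary using (tri<; tri≈; tri>)
  open import Relation.Binary.PropositionalEquality

  open Polynomial (CommutativeRing.isCommutativeSemiring xor-∧-commutativeRing) public

  +ₚ-self : ∀ p → p +ₚ p ≈ₚ 0ₚ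
  +ₚ-self p = coeffwise λ n → trans (coeff-+ₚ p p n) (xor-same (coeff p n))

  +ₚ-cancelʳ : ∀ p q → (p +ₚ q) +ₚ q ≈ₚ p
  +ₚ-cancelʳ p q = begin
    (p +ₚ q) +ₚ q   ≈⟨ +ₚ-assoc p q q ⟩
    p +ₚ (q +ₚ q)   ≈⟨ +ₚ-congˡ p (+ₚ-self q) ⟩
    p +ₚ 0ₚ         ≈⟨ +ₚ-identityʳ p ⟩
    p               ∎
    where open ≈ₚ-Reasoning

  ∣-+ₚ-cancelˡ : ∀ {ψ p q} → ψ ∣ p +ₚ q → ψ ∣ p → ψ ∣ q
  ∣-+ₚ-cancelˡ {p = p} {q} ψ∣p+q ψ∣p =
    ∣ʳ-respʳ-≈ (≈ₚ-trans (+ₚ-congʳ p (+ₚ-comm p q)) (+ₚ-cancelʳ q p)) (∣-+ₚ ψ∣p+q ψ∣p)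

  Nonzero : Poly → Set
  Nonzero p = ∃ λ i → coeff p i ≡ true

  nonzero-≉0ₚ : ∀ {p} → Nonzero p → ¬ p ≈ₚ 0ₚ
  nonzero-≉0ₚ (i , pᵢ≡true) p≈0 with () ← trans (sym pᵢ≡true) (coeff-≡ p≈0 i)

  nonzero-resp-≈ₚ : ∀ {p q} → p ≈ₚ q → Nonzero p → Nonzero q
  nonzero-resp-≈ₚ p≈q (i , pᵢ≡true) = i , trans (sym (coeff-≡ p≈q i)) pᵢ≡true

  nonzero⊎≈0ₚ : ∀ p → Nonzero p ⊎ p ≈ₚ 0ₚ
  nonzero⊎≈0ₚ []          = inj₂ ≈ₚ-refl
  nonzero⊎≈0ₚ (true ∷ p)  = inj₁ (0 , refl)
  nonzero⊎≈0ₚ (false ∷ p) with nonzero⊎≈0ₚ p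
  ... | inj₁ (i , pᵢ≡true) = inj₁ (suc i , pᵢ≡true)
  ... | inj₂ p≈0           = inj₂ (≈ₚ-trans (∷-cong refl p≈0) 0#∷0ₚ)

  -- With the junk value deg 0ₚ = 0.
  deg : Poly → ℕ
  deg []      = 0
  deg (a ∷ p) with nonzero⊎≈0ₚ p
  ... | inj₁ _ = suc (deg p)
  ... | inj₂ _ = 0

  record HasDegree (p : Poly) (d : ℕ) : Set where
    constructor hasDegree
    field
      leading     : coeff p d ≡ true
      coeff-above : ∀ {i} → d < i → coeff p i ≡ false
  open HasDegree

  hasDegree-deg : ∀ {p} → Nonzero p → HasDegree p (deg p)
  hasDegree-deg {a ∷ p} nz with nonzero⊎≈0ₚ p
  ... | inj₁ nz′ = let hasDegree lead above = hasDegree-deg {p} nz′ in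
    hasDegree lead λ { {suc i} (s≤s d<i) → above d<i }
  ... | inj₂ p≈0 with nz
  ...   | zero , a≡true  = hasDegree a≡true λ { {suc i} _ → coeff-≡ p≈0 i }
  ...   | suc i , pᵢ≡true = contradiction p≈0 (nonzero-≉0ₚ (i , pᵢ≡true))

  hasDegree-unique : ∀ {p d e} → HasDegree p d → HasDegree p e → d ≡ e
  hasDegree-unique {p} {d} {e} dᵖ eᵖ with ℕ.<-cmp d e
  ... | tri< d<e _ _ with () ← trans (sym (leading eᵖ)) (coeff-above dᵖ d<e)
  ... | tri≈ _ d≡e _ = d≡e
  ... | tri> _ _ e<d with () ← trans (sym (leading dᵖ)) (coeff-above eᵖ e<d)

  hasDegree-resp-≈ₚ : ∀ {p q d} → p ≈ₚ q → HasDegree p d → HasDegree q d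
  hasDegree-resp-≈ₚ p≈q (hasDegree lead above) =
    hasDegree (trans (sym (coeff-≡ p≈q _)) lead) λ d<i → trans (sym (coeff-≡ p≈q _)) (above d<i)

  hasDegree-nonzero : ∀ {p d} → HasDegree p d → Nonzero p
  hasDegree-nonzero dᵖ = _ , leading dᵖ

  hasDegree-*ₚ : ∀ {p q d e} → HasDegree p d → HasDegree q e → HasDegree (p *ₚ q) (d + e)
  hasDegree-*ₚ {a ∷ p} {q} {zero} (hasDegree a≡true above) eᵠ =
    hasDegree-resp-≈ₚ (≈ₚ-sym (begin
      scale a q +ₚ (false ∷ p *ₚ q)
        ≈⟨ +ₚ-cong (≈ₚ-reflexive (cong (λ a → scale a q) a≡true)) (≈ₚ-trans (∷-cong refl (*ₚ-zeroˡ q p≈0)) 0#∷0ₚ) ⟩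
      scale true q +ₚ 0ₚ              ≈⟨ +ₚ-identityʳ _ ⟩
      scale true q                    ≈⟨ scale-identity q ⟩
      q                               ∎)) eᵠ
    where
    open ≈ₚ-Reasoning
    p≈0 : p ≈ₚ 0ₚ
    p≈0 = coeffwise λ n → above (s≤s z≤n)
  hasDegree-*ₚ {a ∷ p} {q} {suc d} {e} (hasDegree lead above) eᵠ =
    hasDegree (trans (coeff-+ₚ (scale a q) _ (suc (d + e))) (cong₂ _xor_ (scale-above (s≤s (ℕ.m≤n+m e d))) (leading de)))
      λ { {suc i} (s≤s d+e<i) → trans (coeff-+ₚ (scale a q) _ (suc i))
            (cong₂ _xor_ (scale-above (ℕ.<-trans (s≤s (ℕ.m≤n+m e d)) (s≤s d+e<i))) (coeff-above de d+e<i)) }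
    where
    de : HasDegree (p *ₚ q) (d + e)
    de = hasDegree-*ₚ {p} (hasDegree lead λ d<i → above (s≤s d<i)) eᵠ
    scale-above : ∀ {i} → e < i → coeff (scale a q) i ≡ false
    scale-above e<i = trans (coeff-scale a q _) (trans (cong (a ∧_) (coeff-above eᵠ e<i)) (∧-zeroʳ a))

  nonzero-*ₚˡ : ∀ p q → Nonzero (p *ₚ q) → Nonzero p
  nonzero-*ₚˡ p q nz with nonzero⊎≈0ₚ p
  ... | inj₁ nzp = nzp
  ... | inj₂ p≈0 = contradiction (*ₚ-zeroˡ q p≈0) (nonzero-≉0ₚ nz)

  nonzero-*ₚʳ : ∀ p q → Nonzero (p *ₚ q) → Nonzero q
  nonzero-*ₚʳ p q nz = nonzero-*ₚˡ q p (nonzero-resp-≈ₚ (*ₚ-comm p q) nz)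

  deg-*ₚ : ∀ p q → Nonzero (p *ₚ q) → deg (p *ₚ q) ≡ deg p + deg q
  deg-*ₚ p q nz = hasDegree-unique (hasDegree-deg {p *ₚ q} nz)
    (hasDegree-*ₚ (hasDegree-deg {p} (nonzero-*ₚˡ p q nz)) (hasDegree-deg {q} (nonzero-*ₚʳ p q nz)))

  *ₚ-cancelˡ : ∀ {a} u v → Nonzero a → a *ₚ u ≈ₚ a *ₚ v → u ≈ₚ v
  *ₚ-cancelˡ {a} u v nz au≈av with nonzero⊎≈0ₚ (u +ₚ v)
  ... | inj₂ u+v≈0 = begin
    u                ≈⟨ +ₚ-cancelʳ u v ⟨
    (u +ₚ v) +ₚ v    ≈⟨ +ₚ-congʳ v u+v≈0 ⟩
    v                ∎
    where open ≈ₚ-Reasoning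
  ... | inj₁ nz′ = contradiction (begin
    a *ₚ (u +ₚ v)         ≈⟨ *ₚ-distribˡ a u v ⟩
    a *ₚ u +ₚ a *ₚ v      ≈⟨ +ₚ-congʳ (a *ₚ v) au≈av ⟩
    a *ₚ v +ₚ a *ₚ v      ≈⟨ +ₚ-self (a *ₚ v) ⟩
    0ₚ                    ∎) (nonzero-≉0ₚ (hasDegree-nonzero (hasDegree-*ₚ (hasDegree-deg {a} nz) (hasDegree-deg {u +ₚ v} nz′))))
    where open ≈ₚ-Reasoning

  ∣⇒degree≤ : ∀ {ψ u d e} → HasDegree ψ d → HasDegree u e → ψ ∣ u → d ≤ e
  ∣⇒degree≤ {ψ} {d = d} dψ eᵘ (q , q*ψ≈u) with hasDegree-unique (hasDegree-resp-≈ₚ q*ψ≈u (hasDegree-*ₚ qᵈ dψ)) eᵘ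
    where qᵈ = hasDegree-deg {q} (nonzero-*ₚˡ q ψ (nonzero-resp-≈ₚ (≈ₚ-sym q*ψ≈u) (hasDegree-nonzero eᵘ)))
  ... | refl = ℕ.m≤n+m d _

  hasDegree-X^ : ∀ k → HasDegree (X^ k) k
  hasDegree-X^ zero    = hasDegree refl λ { {suc i} _ → refl }
  hasDegree-X^ (suc k) = let hasDegree lead above = hasDegree-X^ k in
    hasDegree lead λ { {suc i} (s≤s k<i) → above k<i }

  X^[1+k]+1ₚ≡ : ∀ k → X^ suc k +ₚ 1ₚ ≡ true ∷ X^ k
  X^[1+k]+1ₚ≡ zero    = refl
  X^[1+k]+1ₚ≡ (suc k) = refl

  hasDegree-X^+1ₚ : ∀ k .{{_ : NonZero k}} → HasDegree (X^ k +ₚ 1ₚ) k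
  hasDegree-X^+1ₚ (suc k) rewrite X^[1+k]+1ₚ≡ k = let hasDegree lead above = hasDegree-X^ k in
    hasDegree lead λ { {suc i} (s≤s k<i) → above k<i }

  +ₚ-telescope : ∀ p q r → (p +ₚ q) +ₚ (q +ₚ r) ≈ₚ p +ₚ r
  +ₚ-telescope p q r = begin
    (p +ₚ q) +ₚ (q +ₚ r)   ≈⟨ +ₚ-assoc p q (q +ₚ r) ⟩
    p +ₚ (q +ₚ (q +ₚ r))   ≈⟨ +ₚ-congˡ p (+ₚ-assoc q q r) ⟨
    p +ₚ ((q +ₚ q) +ₚ r)   ≈⟨ +ₚ-congˡ p (+ₚ-congʳ r (+ₚ-self q)) ⟩
    p +ₚ r                 ∎
    where open ≈ₚ-Reasoning

  X^0+1ₚ≈0ₚ : X^ 0 +ₚ 1ₚ ≈ₚ 0ₚ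
  X^0+1ₚ≈0ₚ = +ₚ-self 1ₚ

  X^[m+n]+X^m≈X^m*[X^n+1] : ∀ m n → X^ (m + n) +ₚ X^ m ≈ₚ X^ m *ₚ (X^ n +ₚ 1ₚ)
  X^[m+n]+X^m≈X^m*[X^n+1] m n = begin
    X^ (m + n) +ₚ X^ m              ≈⟨ +ₚ-cong (X^-+ m n) (≈ₚ-sym (*ₚ-identityʳ (X^ m))) ⟩
    X^ m *ₚ X^ n +ₚ X^ m *ₚ 1ₚ      ≈⟨ *ₚ-distribˡ (X^ m) (X^ n) 1ₚ ⟨
    X^ m *ₚ (X^ n +ₚ 1ₚ)            ∎
    where open ≈ₚ-Reasoning

  geometric : ℕ → ℕ → Poly
  geometric c zero    = 0ₚ
  geometric c (suc j) = X^ (c * j) +ₚ geometric c j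

  X^c+1*geometric : ∀ c j → (X^ c +ₚ 1ₚ) *ₚ geometric c j ≈ₚ X^ (c * j) +ₚ 1ₚ
  X^c+1*geometric c zero    = begin
    (X^ c +ₚ 1ₚ) *ₚ 0ₚ    ≈⟨ *ₚ-zeroʳ (X^ c +ₚ 1ₚ) ⟩
    0ₚ                    ≈⟨ X^0+1ₚ≈0ₚ ⟨
    X^ 0 +ₚ 1ₚ            ≡⟨ cong (λ k → X^ k +ₚ 1ₚ) (ℕ.*-zeroʳ c) ⟨
    X^ (c * 0) +ₚ 1ₚ      ∎
    where open ≈ₚ-Reasoning
  X^c+1*geometric c (suc j) = begin
    (X^ c +ₚ 1ₚ) *ₚ (X^ (c * j) +ₚ geometric c j)
      ≈⟨ *ₚ-distribˡ (X^ c +ₚ 1ₚ) (X^ (c * j)) (geometric c j) ⟩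
    (X^ c +ₚ 1ₚ) *ₚ X^ (c * j) +ₚ (X^ c +ₚ 1ₚ) *ₚ geometric c j
      ≈⟨ +ₚ-cong (*ₚ-comm (X^ c +ₚ 1ₚ) (X^ (c * j))) (X^c+1*geometric c j) ⟩
    X^ (c * j) *ₚ (X^ c +ₚ 1ₚ) +ₚ (X^ (c * j) +ₚ 1ₚ)
      ≈⟨ +ₚ-congʳ (X^ (c * j) +ₚ 1ₚ) (X^[m+n]+X^m≈X^m*[X^n+1] (c * j) c) ⟨
    (X^ (c * j + c) +ₚ X^ (c * j)) +ₚ (X^ (c * j) +ₚ 1ₚ)
      ≈⟨ +ₚ-telescope (X^ (c * j + c)) (X^ (c * j)) 1ₚ ⟩
    X^ (c * j + c) +ₚ 1ₚ
      ≡⟨ cong (λ k → X^ k +ₚ 1ₚ) (trans (ℕ.+-comm (c * j) c) (sym (ℕ.*-suc c j))) ⟩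
    X^ (c * suc j) +ₚ 1ₚ
      ∎
    where open ≈ₚ-Reasoning

  X^c+1∣X^cj+1 : ∀ c j → X^ c +ₚ 1ₚ ∣ X^ (c * j) +ₚ 1ₚ
  X^c+1∣X^cj+1 c j = geometric c j , ≈ₚ-trans (*ₚ-comm (geometric c j) (X^ c +ₚ 1ₚ)) (X^c+1*geometric c j)

  X^c+1∣geometric[1+2k]+1 : ∀ c k → X^ c +ₚ 1ₚ ∣ geometric c (1 + 2 * k) +ₚ 1ₚ
  X^c+1∣geometric[1+2k]+1 c zero    = ∣ʳ-respʳ-≈ (≈ₚ-sym (begin
    (X^ (c * 0) +ₚ 0ₚ) +ₚ 1ₚ   ≈⟨ +ₚ-congʳ 1ₚ (+ₚ-identityʳ (X^ (c * 0))) ⟩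
    X^ (c * 0) +ₚ 1ₚ           ≡⟨ cong (λ k → X^ k +ₚ 1ₚ) (ℕ.*-zeroʳ c) ⟩
    X^ 0 +ₚ 1ₚ                 ≈⟨ X^0+1ₚ≈0ₚ ⟩
    0ₚ                         ∎)) (0ₚ , ≈ₚ-refl)
    where open ≈ₚ-Reasoning
  X^c+1∣geometric[1+2k]+1 c (suc k) = subst (λ m → X^ c +ₚ 1ₚ ∣ geometric c (1 + m) +ₚ 1ₚ) (sym (ℕ.*-suc 2 k))
    (∣ʳ-respʳ-≈ (+ₚ-telescope (geometric c (3 + 2 * k)) (geometric c (1 + 2 * k)) 1ₚ)
      (∣-+ₚ two-steps (X^c+1∣geometric[1+2k]+1 c k)))
    where
    open ≈ₚ-Reasoning
    m = 1 + 2 * k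
    two-steps : X^ c +ₚ 1ₚ ∣ geometric c (2 + m) +ₚ geometric c m
    two-steps = ∣ʳ-respʳ-≈ (≈ₚ-sym (begin
      (X^ (c * suc m) +ₚ (X^ (c * m) +ₚ geometric c m)) +ₚ geometric c m
        ≈⟨ +ₚ-congʳ (geometric c m) (+ₚ-assoc (X^ (c * suc m)) (X^ (c * m)) (geometric c m)) ⟨
      ((X^ (c * suc m) +ₚ X^ (c * m)) +ₚ geometric c m) +ₚ geometric c m
        ≈⟨ +ₚ-cancelʳ (X^ (c * suc m) +ₚ X^ (c * m)) (geometric c m) ⟩
      X^ (c * suc m) +ₚ X^ (c * m)
        ≡⟨ cong (λ n → X^ n +ₚ X^ (c * m)) (trans (ℕ.*-suc c m) (ℕ.+-comm c (c * m))) ⟩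
      X^ (c * m + c) +ₚ X^ (c * m)
        ≈⟨ X^[m+n]+X^m≈X^m*[X^n+1] (c * m) c ⟩
      X^ (c * m) *ₚ (X^ c +ₚ 1ₚ)
        ∎)) (x∣ʳyx (X^ c +ₚ 1ₚ) (X^ (c * m)))

  ∣-X^*-cancel : ∀ {ψ b} a {f} .{{_ : NonZero b}} → ψ ∣ X^ b +ₚ 1ₚ → ψ ∣ X^ a *ₚ f → ψ ∣ f
  ∣-X^*-cancel {ψ} {b} a {f} ψ∣X^b+1 ψ∣X^a*f = ∣-+ₚ-cancelˡ ψ∣X^N*f+f ψ∣X^N*f
    where
    open ≈ₚ-Reasoning
    N = b * a
    a≤N : a ≤ N
    a≤N = ℕ.m≤n*m a b
    ψ∣X^N*f+f : ψ ∣ X^ N *ₚ f +ₚ f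
    ψ∣X^N*f+f = ∣ʳ-respʳ-≈
      (≈ₚ-trans (*ₚ-comm f (X^ N +ₚ 1ₚ)) (≈ₚ-trans (*ₚ-distribʳ f (X^ N) 1ₚ) (+ₚ-congˡ (X^ N *ₚ f) (*ₚ-identityˡ f))))
      (x∣ʳy⇒x∣ʳzy f (∣ʳ-trans ψ∣X^b+1 (X^c+1∣X^cj+1 b a)))
    ψ∣X^N*f : ψ ∣ X^ N *ₚ f
    ψ∣X^N*f = ∣ʳ-respʳ-≈ (begin
      X^ (N ∸ a) *ₚ (X^ a *ₚ f)     ≈⟨ *ₚ-assoc (X^ (N ∸ a)) (X^ a) f ⟨
      (X^ (N ∸ a) *ₚ X^ a) *ₚ f     ≈⟨ *ₚ-congˡ f (X^-+ (N ∸ a) a) ⟨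
      X^ (N ∸ a + a) *ₚ f           ≡⟨ cong (λ k → X^ k *ₚ f) (ℕ.m∸n+n≡m a≤N) ⟩
      X^ N *ₚ f                     ∎) (x∣ʳy⇒x∣ʳzy (X^ (N ∸ a)) ψ∣X^a*f)

  ∣X^m+1∧∣X^[m+n]+1⇒∣X^n+1 : ∀ {ψ} m n → ψ ∣ X^ m +ₚ 1ₚ → ψ ∣ X^ (m + n) +ₚ 1ₚ → ψ ∣ X^ n +ₚ 1ₚ
  ∣X^m+1∧∣X^[m+n]+1⇒∣X^n+1 zero    n _ ψ∣X^n+1 = ψ∣X^n+1
  ∣X^m+1∧∣X^[m+n]+1⇒∣X^n+1 (suc m) n ψ∣X^m+1 ψ∣X^[m+n]+1 = ∣-X^*-cancel (suc m) ψ∣X^m+1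
    (∣ʳ-respʳ-≈ (begin
      (X^ (suc m + n) +ₚ 1ₚ) +ₚ (X^ (suc m) +ₚ 1ₚ)   ≈⟨ +ₚ-congˡ (X^ (suc m + n) +ₚ 1ₚ) (+ₚ-comm (X^ (suc m)) 1ₚ) ⟩
      (X^ (suc m + n) +ₚ 1ₚ) +ₚ (1ₚ +ₚ X^ (suc m))   ≈⟨ +ₚ-telescope (X^ (suc m + n)) 1ₚ (X^ (suc m)) ⟩
      X^ (suc m + n) +ₚ X^ (suc m)                   ≈⟨ X^[m+n]+X^m≈X^m*[X^n+1] (suc m) n ⟩
      X^ (suc m) *ₚ (X^ n +ₚ 1ₚ)                     ∎)
    (∣-+ₚ ψ∣X^[m+n]+1 ψ∣X^m+1))
    where open ≈ₚ-Reasoning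

  module CyclotomicFamily
    (ψ : ℕ → Poly)
    (ψ-family : ∀ n .{{_ : NonZero n}} → X^ n +ₚ 1ₚ ≈ₚ prodₚ (map ψ (divisors n)))
    where

    ψ∣X^n+1 : ∀ n .{{_ : NonZero n}} → ψ n ∣ X^ n +ₚ 1ₚ
    ψ∣X^n+1 n = ∣ʳ-respʳ-≈ (≈ₚ-sym (ψ-family n)) (∈⇒∣prodₚ ψ (∈-divisors⁺ ∣-refl))

    δ : ℕ → ℕ
    δ = deg ∘ ψ

    hasDegree-ψ : ∀ n .{{_ : NonZero n}} → HasDegree (ψ n) (δ n)
    hasDegree-ψ n with q , q*ψ≈ ← ψ∣X^n+1 n =
      hasDegree-deg {ψ n} (nonzero-*ₚʳ q (ψ n) (nonzero-resp-≈ₚ (≈ₚ-sym q*ψ≈) (hasDegree-nonzero (hasDegree-X^+1ₚ n))))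

    δ-sum : ∀ n .{{_ : NonZero n}} → sum (map δ (divisors n)) ≡ n
    δ-sum n = trans (sym (deg-prodₚ (divisors n) nz))
      (hasDegree-unique (hasDegree-deg {prodₚ (map ψ (divisors n))} nz) (hasDegree-resp-≈ₚ (ψ-family n) (hasDegree-X^+1ₚ n)))
      where
      nz : Nonzero (prodₚ (map ψ (divisors n)))
      nz = nonzero-resp-≈ₚ (ψ-family n) (hasDegree-nonzero (hasDegree-X^+1ₚ n))
      deg-prodₚ : ∀ xs → Nonzero (prodₚ (map ψ xs)) → deg (prodₚ (map ψ xs)) ≡ sum (map δ xs)
      deg-prodₚ []       _  = refl
      deg-prodₚ (x ∷ xs) nz = trans (deg-*ₚ (ψ x) _ nz) (cong (δ x +_) (deg-prodₚ xs (nonzero-*ₚʳ (ψ x) _ nz)))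

    open DivisorSum δ δ-sum using (δ-pos; δ[2^[1+e]]≡2^e)

    ψ∤1ₚ : ∀ n .{{_ : NonZero n}} → ¬ ψ n ∣ 1ₚ
    ψ∤1ₚ n ψ∣1 = ℕ.<⇒≱ (δ-pos n) (∣⇒degree≤ (hasDegree-ψ n) (hasDegree-X^ 0) ψ∣1)

    ψ∣geometric : ∀ {b c p} .{{_ : NonZero c}} → c * p ≡ b → c < b → ψ b ∣ geometric c p
    ψ∣geometric {b} {c} {p} c*p≡b c<b = ∣ʳ-respʳ-≈ (≈ₚ-sym geometric≈R)
      (∈⇒∣prodₚ ψ (∈-filter⁺ (¬? ∘ (_∣? c)) (∈-divisors⁺ ∣-refl) λ b∣c → ℕ.<⇒≱ c<b (∣⇒≤ b∣c)))
      where
      instance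
        b≢0 : NonZero b
        b≢0 = >-nonZero (ℕ.<-≤-trans (ℕ.>-nonZero⁻¹ c) (ℕ.<⇒≤ c<b))
      open ≈ₚ-Reasoning
      c∣b : c ℕ.∣ b
      c∣b = divides p (trans (sym c*p≡b) (ℕ.*-comm c p))
      R = prodₚ (map ψ (filter (¬? ∘ (_∣? c)) (divisors b)))
      geometric≈R : geometric c p ≈ₚ R
      geometric≈R = *ₚ-cancelˡ {X^ c +ₚ 1ₚ} (geometric c p) R (hasDegree-nonzero (hasDegree-X^+1ₚ c)) (begin
        (X^ c +ₚ 1ₚ) *ₚ geometric c p                                     ≈⟨ X^c+1*geometric c p ⟩
        X^ (c * p) +ₚ 1ₚ                                                  ≡⟨ cong (λ n → X^ n +ₚ 1ₚ) c*p≡b ⟩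
        X^ b +ₚ 1ₚ                                                        ≈⟨ ψ-family b ⟩
        prodₚ (map ψ (divisors b))                                        ≈⟨ prodₚ-partition (_∣? c) ψ (divisors b) ⟩
        prodₚ (map ψ (filter (_∣? c) (divisors b))) *ₚ R                  ≡⟨ cong (λ ds → prodₚ (map ψ ds) *ₚ R) (filter-∣-divisors c∣b) ⟩
        prodₚ (map ψ (divisors c)) *ₚ R                                   ≈⟨ *ₚ-congˡ R (ψ-family c) ⟨
        (X^ c +ₚ 1ₚ) *ₚ R                                                 ∎)

    -- With b = cp and p² = 1 + 8w we get bp = c + 8cw, whence ψ_b ∣ x^c + 1.
    oddDivisor⇒ψ∤X^8+1 : ∀ {b k} .{{_ : NonZero b}} → 1 ≤ k → 1 + 2 * k ℕ.∣ b → ¬ ψ b ∣ X^ 8 +ₚ 1ₚ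
    oddDivisor⇒ψ∤X^8+1 {b} {k} 1≤k (divides c refl) ψ∣X^8+1 = ψ∤1ₚ b (∣-+ₚ-cancelˡ ψ∣geometric+1 (ψ∣geometric refl c<b))
      where
      p = 1 + 2 * k
      w = proj₁ (odd² k)
      instance
        c≢0 : NonZero c
        c≢0 = ℕ.m*n≢0⇒m≢0 c
      c<b : c < c * p
      c<b = ℕ.m<m*n c p (s≤s (ℕ.≤-trans 1≤k (ℕ.m≤m+n k _)))
      bp≡8cw+c : c * p * p ≡ 8 * (c * w) + c
      bp≡8cw+c = begin
        c * p * p          ≡⟨ ℕ.*-assoc c p p ⟩
        c * (p * p)        ≡⟨ cong (c *_) (proj₂ (odd² k)) ⟩
        c * (1 + 8 * w)    ≡⟨ rearrange c w ⟩
        8 * (c * w) + c    ∎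
        where
        open ≡-Reasoning
        rearrange : ∀ c w → c * (1 + 8 * w) ≡ 8 * (c * w) + c
        rearrange = solve-∀
      ψ∣X^c+1 : ψ b ∣ X^ c +ₚ 1ₚ
      ψ∣X^c+1 = ∣X^m+1∧∣X^[m+n]+1⇒∣X^n+1 (8 * (c * w)) c
        (∣ʳ-trans ψ∣X^8+1 (X^c+1∣X^cj+1 8 (c * w)))
        (subst (λ n → ψ b ∣ X^ n +ₚ 1ₚ) bp≡8cw+c (∣ʳ-trans (ψ∣X^n+1 b) (X^c+1∣X^cj+1 b p)))
      ψ∣geometric+1 : ψ b ∣ geometric c p +ₚ 1ₚ
      ψ∣geometric+1 = ∣ʳ-trans ψ∣X^c+1 (X^c+1∣geometric[1+2k]+1 c k)

    ψ[2^e]∣geometric⇒e≤3 : ∀ e → ψ (2 ^ e) ∣ geometric 1 8 → e ≤ 3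
    ψ[2^e]∣geometric⇒e≤3 e@(suc (suc (suc (suc e′)))) ψ∣G = contradiction (begin
      8                  ≤⟨ ℕ.^-monoʳ-≤ 2 (ℕ.m≤m+n 3 e′) ⟩
      2 ^ (3 + e′)       ≡⟨ δ[2^[1+e]]≡2^e (3 + e′) ⟨
      δ (2 ^ e)          ≤⟨ ∣⇒degree≤ (hasDegree-ψ (2 ^ e) {{ℕ.m^n≢0 2 e}}) degree-7 ψ∣G ⟩
      7                  ∎) (ℕ.<⇒≱ ℕ.≤-refl)
      where
      open ℕ.≤-Reasoning
      degree-7 : HasDegree (geometric 1 8) 7
      degree-7 = hasDegree refl λ { (s≤s (s≤s (s≤s (s≤s (s≤s (s≤s (s≤s (s≤s _)))))))) → refl }
    ψ[2^e]∣geometric⇒e≤3 0 _ = z≤n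
    ψ[2^e]∣geometric⇒e≤3 1 _ = s≤s z≤n
    ψ[2^e]∣geometric⇒e≤3 2 _ = s≤s (s≤s z≤n)
    ψ[2^e]∣geometric⇒e≤3 3 _ = s≤s (s≤s (s≤s z≤n))

    ψ∣geometric⇒4⊎8 : ∀ {b} .{{_ : NonZero b}} → 3 ≤ b → ψ b ∣ geometric 1 8 → b ≡ 4 ⊎ b ≡ 8
    ψ∣geometric⇒4⊎8 {b} 3≤b ψ∣G with powerOfTwo⊎oddDivisor b
    ... | inj₂ (k , 1≤k , odd∣b) = contradiction ψ∣X^8+1 (oddDivisor⇒ψ∤X^8+1 1≤k odd∣b)
      where
      ψ∣X^8+1 : ψ b ∣ X^ 8 +ₚ 1ₚ
      ψ∣X^8+1 = ∣ʳ-trans ψ∣G (xy≈z⇒y∣ʳz (X^ 1 +ₚ 1ₚ) (geometric 1 8) (X^c+1*geometric 1 8))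
    ... | inj₁ (e , refl) = powerOfTwo e 3≤b (ψ[2^e]∣geometric⇒e≤3 e ψ∣G)
      where
      powerOfTwo : ∀ e → 3 ≤ 2 ^ e → e ≤ 3 → 2 ^ e ≡ 4 ⊎ 2 ^ e ≡ 8
      powerOfTwo 0 (s≤s ()) _
      powerOfTwo 1 (s≤s (s≤s ())) _
      powerOfTwo 2 _ _ = inj₁ refl
      powerOfTwo 3 _ _ = inj₂ refl
      powerOfTwo (suc (suc (suc (suc _)))) _ (s≤s (s≤s (s≤s ())))

    ψ∣X^u*geometric⇒4⊎8 : ∀ {b} u → 3 ≤ b → ψ b ∣ X^ u *ₚ geometric 1 8 → b ≡ 4 ⊎ b ≡ 8
    ψ∣X^u*geometric⇒4⊎8 {b} u 3≤b ψ∣X^u*G = ψ∣geometric⇒4⊎8 3≤b (∣-X^*-cancel u (ψ∣X^n+1 b) ψ∣X^u*G)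
      where
      instance
        b≢0 : NonZero b
        b≢0 = >-nonZero (ℕ.<-≤-trans (s≤s z≤n) 3≤b)

module TwoIntegral where
  open import Defs using (ι)
  open import Data.Bool.Base using (Bool; true; false; _xor_; _∧_)
  open import Data.Bool.Properties using (∧-identityʳ)
  open import Data.Nat.Base using (suc)
  import Data.Nat.Properties as ℕ
  open import Data.Integer.Base as ℤ using (ℤ; +_; -[1+_])
  import Data.Integer.Properties as ℤ
  open import Data.Integer.Tactic.RingSolver using (solve)
  open import Data.Rational.Base as ℚ using (ℚ; 0ℚ; 1ℚ; toℚᵘ)
  import Data.Rational.Properties as ℚ
  open import Data.Rational.Properties
    using (toℚᵘ-fromℚᵘ; toℚᵘ-injective; toℚᵘ-homo-+; toℚᵘ-homo-*; toℚᵘ-cong)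
  import Data.Rational.Solver as ℚ-Solver
  open import Data.Rational.Unnormalised.Base as ℚᵘ using (mkℚᵘ; _≃_; *≡*)
  import Data.Rational.Unnormalised.Properties as ℚᵘ
  open import Data.List.Base using ([]; _∷_)
  open import Relation.Nullary using (contradiction)
  open import Relation.Binary.PropositionalEquality

  bit : Bool → ℤ
  bit false = + 0
  bit true  = + 1

  infixr 4 _,_
  record Parity (n : ℤ) (β : Bool) : Set where
    constructor _,_
    field
      half  : ℤ
      n≡2*half+bit : n ≡ + 2 ℤ.* half ℤ.+ bit β

  parity-+ : ∀ {a b α β} → Parity a α → Parity b β → Parity (a ℤ.+ b) (α xor β)
  parity-+ {α = false} {false} (k , refl) (l , refl) = k ℤ.+ l , solve (k ∷ l ∷ [])
  parity-+ {α = false} {true}  (k , refl) (l , refl) = k ℤ.+ l , solve (k ∷ l ∷ [])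
  parity-+ {α = true}  {false} (k , refl) (l , refl) = k ℤ.+ l , solve (k ∷ l ∷ [])
  parity-+ {α = true}  {true}  (k , refl) (l , refl) = k ℤ.+ l ℤ.+ + 1 , solve (k ∷ l ∷ [])

  parity-* : ∀ {a b α β} → Parity a α → Parity b β → Parity (a ℤ.* b) (α ∧ β)
  parity-* {α = false} {false} (k , refl) (l , refl) = + 2 ℤ.* k ℤ.* l , solve (k ∷ l ∷ [])
  parity-* {α = false} {true}  (k , refl) (l , refl) = + 2 ℤ.* k ℤ.* l ℤ.+ k , solve (k ∷ l ∷ [])
  parity-* {α = true}  {false} (k , refl) (l , refl) = + 2 ℤ.* k ℤ.* l ℤ.+ l , solve (k ∷ l ∷ [])
  parity-* {α = true}  {true}  (k , refl) (l , refl) = + 2 ℤ.* k ℤ.* l ℤ.+ k ℤ.+ l , solve (k ∷ l ∷ [])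

  parity-*-odd : ∀ {a b α} → Parity a α → Parity b true → Parity (a ℤ.* b) α
  parity-*-odd {α = α} pa pb = subst (Parity _) (∧-identityʳ α) (parity-* pa pb)

  parity-unique : ∀ {a α β} → Parity a α → Parity a β → α ≡ β
  parity-unique {α = false} {false} _ _ = refl
  parity-unique {α = true}  {true}  _ _ = refl
  parity-unique {α = false} {true}  (k , a≡) (l , a≡′) = contradiction (trans (sym a≡′) a≡) (odd≢even l k)
    where
    odd≢even : ∀ l k → + 2 ℤ.* l ℤ.+ + 1 ≢ + 2 ℤ.* k ℤ.+ + 0
    odd≢even l k eq = 2*x≢1 (k ℤ.- l) (begin
      + 2 ℤ.* (k ℤ.- l)                   ≡⟨ solve (k ∷ l ∷ []) ⟩
      (+ 2 ℤ.* k ℤ.+ + 0) ℤ.- + 2 ℤ.* l   ≡⟨ cong (ℤ._- + 2 ℤ.* l) eq ⟨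
      (+ 2 ℤ.* l ℤ.+ + 1) ℤ.- + 2 ℤ.* l   ≡⟨ solve (l ∷ []) ⟩
      + 1                                 ∎)
      where
      open ≡-Reasoning
      2*x≢1 : ∀ x → + 2 ℤ.* x ≢ + 1
      2*x≢1 (+ 0)        ()
      2*x≢1 (+ (suc n))  eq = ℕ.m+1+n≢0 n (ℕ.suc-injective (ℤ.+-injective eq))
      2*x≢1 -[1+ n ]     ()
  parity-unique {α = true}  {false} pa pb = sym (parity-unique pb pa)

  private
    toℚᵘ-ι : ∀ z → toℚᵘ (ι z) ≃ mkℚᵘ z 0
    toℚᵘ-ι z = toℚᵘ-fromℚᵘ (mkℚᵘ z 0)

  ι-+ : ∀ a b → ι (a ℤ.+ b) ≡ ι a ℚ.+ ι b
  ι-+ a b = toℚᵘ-injective (begin-equality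
    toℚᵘ (ι (a ℤ.+ b))              ≃⟨ toℚᵘ-ι (a ℤ.+ b) ⟩
    mkℚᵘ (a ℤ.+ b) 0                ≃⟨ *≡* (cong (ℤ._* + 1) (cong₂ ℤ._+_ (ℤ.*-identityʳ a) (ℤ.*-identityʳ b))) ⟨
    mkℚᵘ a 0 ℚᵘ.+ mkℚᵘ b 0          ≃⟨ ℚᵘ.+-cong (toℚᵘ-ι a) (toℚᵘ-ι b) ⟨
    toℚᵘ (ι a) ℚᵘ.+ toℚᵘ (ι b)      ≃⟨ toℚᵘ-homo-+ (ι a) (ι b) ⟨
    toℚᵘ (ι a ℚ.+ ι b)              ∎)
    where open ℚᵘ.≤-Reasoning

  ι-* : ∀ a b → ι (a ℤ.* b) ≡ ι a ℚ.* ι b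
  ι-* a b = toℚᵘ-injective (begin-equality
    toℚᵘ (ι (a ℤ.* b))              ≃⟨ toℚᵘ-ι (a ℤ.* b) ⟩
    mkℚᵘ a 0 ℚᵘ.* mkℚᵘ b 0          ≃⟨ ℚᵘ.*-cong (toℚᵘ-ι a) (toℚᵘ-ι b) ⟨
    toℚᵘ (ι a) ℚᵘ.* toℚᵘ (ι b)      ≃⟨ toℚᵘ-homo-* (ι a) (ι b) ⟨
    toℚᵘ (ι a ℚ.* ι b)              ∎)
    where open ℚᵘ.≤-Reasoning

  ι-injective : ∀ {a b} → ι a ≡ ι b → a ≡ b
  ι-injective {a} {b} ιa≡ιb
    with *≡* eq ← ℚᵘ.≃-trans (ℚᵘ.≃-sym (toℚᵘ-ι a)) (ℚᵘ.≃-trans (toℚᵘ-cong ιa≡ιb) (toℚᵘ-ι b)) =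
    trans (sym (ℤ.*-identityʳ a)) (trans eq (ℤ.*-identityʳ b))

  -- q ↦ β : q lies in ℤ₍₂₎ and reduces to β modulo 2.
  infix 4 _↦_
  record _↦_ (q : ℚ) (β : Bool) : Set where
    constructor fraction
    field
      numerator denominator : ℤ
      numerator-parity      : Parity numerator β
      denominator-odd       : Parity denominator true
      q*denominator≡numerator : q ℚ.* ι denominator ≡ ι numerator

  open ℚ-Solver.+-*-Solver using (_:+_; _:*_; :-_; _:=_; con) renaming (solve to ℚ-solve)

  ↦-ι : ∀ {z β} → Parity z β → ι z ↦ β
  ↦-ι {z} pz = fraction z (+ 1) pz (+ 0 , refl) (ℚ.*-identityʳ (ι z))

  0ℚ↦false : 0ℚ ↦ false
  0ℚ↦false = ↦-ι (+ 0 , refl)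

  1ℚ↦true : 1ℚ ↦ true
  1ℚ↦true = ↦-ι (+ 0 , refl)

  ↦-unique : ∀ {q α β} → q ↦ α → q ↦ β → α ≡ β
  ↦-unique {q} (fraction n d pn pd eq) (fraction n′ d′ pn′ pd′ eq′) =
    parity-unique (subst (λ m → Parity m _) n*d′≡n′*d (parity-*-odd pn pd′)) (parity-*-odd pn′ pd)
    where
    open ≡-Reasoning
    n*d′≡n′*d : n ℤ.* d′ ≡ n′ ℤ.* d
    n*d′≡n′*d = ι-injective (begin
      ι (n ℤ.* d′)                 ≡⟨ ι-* n d′ ⟩
      ι n ℚ.* ι d′                 ≡⟨ cong (ℚ._* ι d′) eq ⟨
      q ℚ.* ι d ℚ.* ι d′           ≡⟨ ℚ-solve 3 (λ q x y → q :* x :* y := q :* y :* x) refl q (ι d) (ι d′) ⟩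
      q ℚ.* ι d′ ℚ.* ι d           ≡⟨ cong (ℚ._* ι d) eq′ ⟩
      ι n′ ℚ.* ι d                 ≡⟨ ι-* n′ d ⟨
      ι (n′ ℤ.* d)                 ∎)

  ↦-+ : ∀ {a b α β} → a ↦ α → b ↦ β → a ℚ.+ b ↦ α xor β
  ↦-+ {a} {b} (fraction n d pn pd eq) (fraction n′ d′ pn′ pd′ eq′) =
    fraction (n ℤ.* d′ ℤ.+ n′ ℤ.* d) (d ℤ.* d′)
      (parity-+ (parity-*-odd pn pd′) (parity-*-odd pn′ pd)) (parity-* pd pd′) (begin
      (a ℚ.+ b) ℚ.* ι (d ℤ.* d′)                  ≡⟨ cong ((a ℚ.+ b) ℚ.*_) (ι-* d d′) ⟩
      (a ℚ.+ b) ℚ.* (ι d ℚ.* ι d′)                ≡⟨ ℚ-solve 4 (λ a b x y → (a :+ b) :* (x :* y) := a :* x :* y :+ b :* y :* x) refl a b (ι d) (ι d′) ⟩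
      a ℚ.* ι d ℚ.* ι d′ ℚ.+ b ℚ.* ι d′ ℚ.* ι d   ≡⟨ cong₂ (λ x y → x ℚ.* ι d′ ℚ.+ y ℚ.* ι d) eq eq′ ⟩
      ι n ℚ.* ι d′ ℚ.+ ι n′ ℚ.* ι d               ≡⟨ cong₂ ℚ._+_ (ι-* n d′) (ι-* n′ d) ⟨
      ι (n ℤ.* d′) ℚ.+ ι (n′ ℤ.* d)               ≡⟨ ι-+ (n ℤ.* d′) (n′ ℤ.* d) ⟨
      ι (n ℤ.* d′ ℤ.+ n′ ℤ.* d)                   ∎)
    where open ≡-Reasoning

  ↦-* : ∀ {a b α β} → a ↦ α → b ↦ β → a ℚ.* b ↦ α ∧ β
  ↦-* {a} {b} (fraction n d pn pd eq) (fraction n′ d′ pn′ pd′ eq′) =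
    fraction (n ℤ.* n′) (d ℤ.* d′) (parity-* pn pn′) (parity-* pd pd′) (begin
      a ℚ.* b ℚ.* ι (d ℤ.* d′)           ≡⟨ cong (a ℚ.* b ℚ.*_) (ι-* d d′) ⟩
      a ℚ.* b ℚ.* (ι d ℚ.* ι d′)         ≡⟨ ℚ-solve 4 (λ a b x y → a :* b :* (x :* y) := a :* x :* (b :* y)) refl a b (ι d) (ι d′) ⟩
      a ℚ.* ι d ℚ.* (b ℚ.* ι d′)         ≡⟨ cong₂ ℚ._*_ eq eq′ ⟩
      ι n ℚ.* ι n′                       ≡⟨ ι-* n n′ ⟨
      ι (n ℤ.* n′)                       ∎)
    where open ≡-Reasoning

  ↦-neg : ∀ {a α} → a ↦ α → ℚ.- a ↦ α
  ↦-neg {a} a↦ = subst (_↦ _) (ℚ-solve 1 (λ a → :- con 1ℚ :* a := :- a) refl a) (↦-* (↦-ι (ℤ.- + 1 , refl)) a↦)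

  ↦-∸ : ∀ {x y α β} → x ℚ.+ y ↦ α → x ↦ β → y ↦ α xor β
  ↦-∸ {x} {y} x+y↦ x↦ = subst (_↦ _) (ℚ-solve 2 (λ x y → x :+ y :+ :- x := y) refl x y) (↦-+ x+y↦ (↦-neg x↦))

  ↦-cancelˡ : ∀ {a q β} → a ↦ true → a ℚ.* q ↦ β → q ↦ β
  ↦-cancelˡ {a} {q} (fraction n d pn pd eq) (fraction n′ d′ pn′ pd′ eq′) =
    fraction (n′ ℤ.* d) (n ℤ.* d′) (parity-*-odd pn′ pd) (parity-* pn pd′) (begin
      q ℚ.* ι (n ℤ.* d′)              ≡⟨ cong (q ℚ.*_) (trans (ι-* n d′) (cong (ℚ._* ι d′) (sym eq))) ⟩
      q ℚ.* (a ℚ.* ι d ℚ.* ι d′)      ≡⟨ ℚ-solve 4 (λ a q x y → q :* (a :* x :* y) := a :* q :* y :* x) refl a q (ι d) (ι d′) ⟩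
      a ℚ.* q ℚ.* ι d′ ℚ.* ι d        ≡⟨ cong (ℚ._* ι d) eq′ ⟩
      ι n′ ℚ.* ι d                    ≡⟨ ι-* n′ d ⟨
      ι (n′ ℤ.* d)                    ∎)
    where open ≡-Reasoning

module ReductionMod2 where
  import Defs
  open Defs using (coeff; sumₚ; mono; xpow-1; IsCyclotomicFamily; _∣ₚ_; divisors)
  open TwoIntegral
  open Divisors
  open import Algebra.Structures using (IsCommutativeRing)
  open import Data.Bool.Base using (true; false)
  open import Data.Nat.Base as ℕ using (ℕ; zero; suc; NonZero; _<_)
  open import Data.Nat.Induction using (<-rec)
  open import Data.Rational.Base as ℚ using (ℚ; 0ℚ; 1ℚ)
  import Data.Rational.Properties as ℚ
  open import Data.List.Base as List using (List; []; _∷_; map; drop)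
  open import Data.List.Properties using (map-++)
  open import Data.List.Relation.Binary.Pointwise using (Pointwise; []; _∷_)
  open import Data.List.Relation.Unary.All as All using (All; []; _∷_)
  open import Data.Product.Base using (∃; _×_; _,_; proj₁; proj₂)
  open import Function.Base using (_∘_)
  open import Relation.Binary.PropositionalEquality

  module ℚ[X] = Polynomial (IsCommutativeRing.isCommutativeSemiring ℚ.+-*-isCommutativeRing)

  open 𝔽₂[X] using (_+ₚ_; _*ₚ_; X^_; 1ₚ; _∣_; _,_) renaming (Poly to Poly₂)

  Defs-coeff≡ : ∀ p n → coeff p n ≡ ℚ[X].coeff p n
  Defs-coeff≡ []      n       = refl
  Defs-coeff≡ (a ∷ p) zero    = refl
  Defs-coeff≡ (a ∷ p) (suc n) = Defs-coeff≡ p n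

  Defs-+ₚ≡ : ∀ p q → p Defs.+ₚ q ≡ p ℚ[X].+ₚ q
  Defs-+ₚ≡ []      q       = refl
  Defs-+ₚ≡ (a ∷ p) []      = refl
  Defs-+ₚ≡ (a ∷ p) (b ∷ q) = cong (a ℚ.+ b ∷_) (Defs-+ₚ≡ p q)

  Defs-*ₚ≡ : ∀ p q → p Defs.*ₚ q ≡ p ℚ[X].*ₚ q
  Defs-*ₚ≡ []      q = refl
  Defs-*ₚ≡ (a ∷ p) q = trans (Defs-+ₚ≡ (Defs.scale a q) _) (cong (λ r → ℚ[X].scale a q ℚ[X].+ₚ (0ℚ ∷ r)) (Defs-*ₚ≡ p q))

  Defs-prodₚ≡ : ∀ ps → Defs.prodₚ ps ≡ ℚ[X].prodₚ ps
  Defs-prodₚ≡ []       = refl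
  Defs-prodₚ≡ (p ∷ ps) = trans (Defs-*ₚ≡ p _) (cong (p ℚ[X].*ₚ_) (Defs-prodₚ≡ ps))

  Defs-≈ₚ⇒≈ₚ : ∀ {p q} → p Defs.≈ₚ q → p ℚ[X].≈ₚ q
  Defs-≈ₚ⇒≈ₚ {p} {q} p≈q = ℚ[X].coeffwise λ n → trans (sym (Defs-coeff≡ p n)) (trans (p≈q n) (Defs-coeff≡ q n))

  infix 4 _↦ₚ_
  record _↦ₚ_ (p : ℚ[X].Poly) (p̄ : Poly₂) : Set where
    constructor coeffwise
    field coeff-↦ : ∀ n → ℚ[X].coeff p n ↦ 𝔽₂[X].coeff p̄ n
  open _↦ₚ_

  ↦ₚ-respˡ : ∀ {p q p̄} → p ℚ[X].≈ₚ q → p ↦ₚ p̄ → q ↦ₚ p̄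
  ↦ₚ-respˡ p≈q p↦ = coeffwise λ n → subst (_↦ _) (ℚ[X].coeff-≡ p≈q n) (coeff-↦ p↦ n)

  ↦ₚ-respʳ : ∀ {p p̄ q̄} → p̄ 𝔽₂[X].≈ₚ q̄ → p ↦ₚ p̄ → p ↦ₚ q̄
  ↦ₚ-respʳ p̄≈q̄ p↦ = coeffwise λ n → subst (_ ↦_) (𝔽₂[X].coeff-≡ p̄≈q̄ n) (coeff-↦ p↦ n)

  ↦ₚ-unique : ∀ {p p̄ q̄} → p ↦ₚ p̄ → p ↦ₚ q̄ → p̄ 𝔽₂[X].≈ₚ q̄
  ↦ₚ-unique p↦p̄ p↦q̄ = 𝔽₂[X].coeffwise λ n → ↦-unique (coeff-↦ p↦p̄ n) (coeff-↦ p↦q̄ n)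

  ↦ₚ-[] : [] ↦ₚ []
  ↦ₚ-[] = coeffwise λ _ → 0ℚ↦false

  ↦ₚ-∷ : ∀ {a β p p̄} → a ↦ β → p ↦ₚ p̄ → a ∷ p ↦ₚ β ∷ p̄
  ↦ₚ-∷ a↦ p↦ = coeffwise λ { zero → a↦ ; (suc n) → coeff-↦ p↦ n }

  ↦ₚ-+ : ∀ {p p̄ q q̄} → p ↦ₚ p̄ → q ↦ₚ q̄ → p ℚ[X].+ₚ q ↦ₚ p̄ +ₚ q̄
  ↦ₚ-+ {p} {p̄} {q} {q̄} p↦ q↦ = coeffwise λ n →
    subst₂ _↦_ (sym (ℚ[X].coeff-+ₚ p q n)) (sym (𝔽₂[X].coeff-+ₚ p̄ q̄ n)) (↦-+ (coeff-↦ p↦ n) (coeff-↦ q↦ n))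

  ↦ₚ-scale : ∀ {c γ p p̄} → c ↦ γ → p ↦ₚ p̄ → ℚ[X].scale c p ↦ₚ 𝔽₂[X].scale γ p̄
  ↦ₚ-scale {c} {γ} {p} {p̄} c↦ p↦ = coeffwise λ n →
    subst₂ _↦_ (sym (ℚ[X].coeff-scale c p n)) (sym (𝔽₂[X].coeff-scale γ p̄ n)) (↦-* c↦ (coeff-↦ p↦ n))

  ↦ₚ-* : ∀ {p p̄ q q̄} → p ↦ₚ p̄ → q ↦ₚ q̄ → p ℚ[X].*ₚ q ↦ₚ p̄ *ₚ q̄
  ↦ₚ-* {[]}    {p̄} {q} {q̄} p↦ q↦ =
    ↦ₚ-respʳ (𝔽₂[X].≈ₚ-sym (𝔽₂[X].*ₚ-zeroˡ q̄ (↦ₚ-unique p↦ ↦ₚ-[]))) ↦ₚ-[]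
  ↦ₚ-* {a ∷ p} {p̄} {q} {q̄} p↦ q↦ = ↦ₚ-respʳ (𝔽₂[X].*ₚ-congˡ q̄ (𝔽₂[X].∷-head-drop p̄))
    (↦ₚ-+ (↦ₚ-scale (coeff-↦ p↦ 0) q↦) (↦ₚ-∷ 0ℚ↦false (↦ₚ-* tail↦ q↦)))
    where
    tail↦ : p ↦ₚ drop 1 p̄
    tail↦ = coeffwise λ n → subst (_ ↦_) (sym (𝔽₂[X].coeff-drop p̄ n)) (coeff-↦ p↦ (suc n))

  ↦ₚ-prodₚ : ∀ {A : Set} (f : A → ℚ[X].Poly) (g : A → Poly₂) xs →
    All (λ x → f x ↦ₚ g x) xs → ℚ[X].prodₚ (map f xs) ↦ₚ 𝔽₂[X].prodₚ (map g xs)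
  ↦ₚ-prodₚ f g []       []         = ↦ₚ-∷ 1ℚ↦true ↦ₚ-[]
  ↦ₚ-prodₚ f g (x ∷ xs) (fx↦ ∷ f↦) = ↦ₚ-* fx↦ (↦ₚ-prodₚ f g xs f↦)

  Integral : ℚ[X].Poly → Set
  Integral p = ∀ n → ∃ (ℚ[X].coeff p n ↦_)

  ↦ₚ-quotient : ∀ {a ā} q → a ↦ₚ ā → ℚ[X].coeff a 0 ↦ true → Integral (q ℚ[X].*ₚ a) → ∃ (q ↦ₚ_)
  ↦ₚ-quotient     []      _  _   _           = [] , ↦ₚ-[]
  ↦ₚ-quotient {a} (c ∷ q) a↦ a₀↦ ca-integral =
    let (q̄ , q↦) = ↦ₚ-quotient q a↦ a₀↦ qa-integral in γ ∷ q̄ , ↦ₚ-∷ c↦ q↦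
    where
    γ = proj₁ (ca-integral 0)
    c↦ : c ↦ γ
    c↦ = ↦-cancelˡ a₀↦ (subst (_↦ γ) (trans (ℚ[X].coeff₀-*ₚ (c ∷ q) a) (ℚ.*-comm c _)) (proj₂ (ca-integral 0)))
    qa-integral : Integral (q ℚ[X].*ₚ a)
    qa-integral n = _ , ↦-∸ (subst (_↦ _) coeff-suc (proj₂ (ca-integral (suc n)))) (↦-* c↦ (coeff-↦ a↦ (suc n)))
      where
      coeff-suc : ℚ[X].coeff ((c ∷ q) ℚ[X].*ₚ a) (suc n) ≡ c ℚ.* ℚ[X].coeff a (suc n) ℚ.+ ℚ[X].coeff (q ℚ[X].*ₚ a) n
      coeff-suc = trans (ℚ[X].coeff-+ₚ (ℚ[X].scale c a) _ (suc n)) (cong (ℚ._+ _) (ℚ[X].coeff-scale c a (suc n)))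

  mono-↦-X^ : ∀ {c} k → c ↦ true → mono c k ↦ₚ X^ k
  mono-↦-X^ zero    c↦ = ↦ₚ-∷ c↦ ↦ₚ-[]
  mono-↦-X^ (suc k) c↦ = ↦ₚ-∷ 0ℚ↦false (mono-↦-X^ k c↦)

  mono-↦-0ₚ : ∀ {c} k → c ↦ false → mono c k ↦ₚ 𝔽₂[X].0ₚ
  mono-↦-0ₚ zero    c↦ = ↦ₚ-respʳ 𝔽₂[X].0#∷0ₚ (↦ₚ-∷ c↦ ↦ₚ-[])
  mono-↦-0ₚ (suc k) c↦ = ↦ₚ-respʳ 𝔽₂[X].0#∷0ₚ (↦ₚ-∷ 0ℚ↦false (mono-↦-0ₚ k c↦))

  sumₚ-↦ : ∀ {ps p̄s} → Pointwise _↦ₚ_ ps p̄s → sumₚ ps ↦ₚ 𝔽₂[X].sumₚ p̄s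
  sumₚ-↦ []                      = ↦ₚ-[]
  sumₚ-↦ {p ∷ ps} (p↦ ∷ ps↦)     = subst (_↦ₚ _) (sym (Defs-+ₚ≡ p (sumₚ ps))) (↦ₚ-+ p↦ (sumₚ-↦ ps↦))

  xpow-1-↦ : ∀ n → xpow-1 n ↦ₚ X^ n +ₚ 1ₚ
  xpow-1-↦ n = subst (_↦ₚ X^ n +ₚ 1ₚ) (sym (Defs-+ₚ≡ (mono 1ℚ n) _))
    (↦ₚ-+ (mono-↦-X^ n 1ℚ↦true) (mono-↦-X^ 0 (↦-neg 1ℚ↦true)))

  OddIntegral : ℚ[X].Poly → Set
  OddIntegral p = ∃ (p ↦ₚ_) × ℚ[X].coeff p 0 ↦ true

  prodₚ-oddIntegral : ∀ {A : Set} (f : A → ℚ[X].Poly) {xs} → All (OddIntegral ∘ f) xs → OddIntegral (ℚ[X].prodₚ (map f xs))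
  prodₚ-oddIntegral f []                          = (1ₚ , ↦ₚ-∷ 1ℚ↦true ↦ₚ-[]) , 1ℚ↦true
  prodₚ-oddIntegral f {x ∷ xs} (((p̄ , fx↦) , fx₀↦) ∷ rest) =
    let ((q̄ , prod↦) , prod₀↦) = prodₚ-oddIntegral f rest in
    (p̄ *ₚ q̄ , ↦ₚ-* fx↦ prod↦) , subst (_↦ true) (sym (ℚ[X].coeff₀-*ₚ (f x) _)) (↦-* fx₀↦ prod₀↦)

  module CyclotomicReduction (Φ : ℕ → Defs.Poly) (Φ-cyclotomic : IsCyclotomicFamily Φ) where

    Φ-family : ∀ k → xpow-1 (suc k) ℚ[X].≈ₚ ℚ[X].prodₚ (map Φ (divisors (suc k)))
    Φ-family k = ℚ[X].≈ₚ-trans (Defs-≈ₚ⇒≈ₚ (Φ-cyclotomic k))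
      (ℚ[X].≈ₚ-reflexive (Defs-prodₚ≡ (map Φ (divisors (suc k)))))

    Φ*properFactors≈ : ∀ k → Φ (suc k) ℚ[X].*ₚ ℚ[X].prodₚ (map Φ (properDivisors (suc k))) ℚ[X].≈ₚ xpow-1 (suc k)
    Φ*properFactors≈ k = ℚ[X].≈ₚ-sym (begin
      xpow-1 (suc k)                                        ≈⟨ Φ-family k ⟩
      ℚ[X].prodₚ (map Φ (divisors (suc k)))                 ≡⟨ cong (ℚ[X].prodₚ ∘ map Φ) (divisors-∷ʳ k) ⟩
      ℚ[X].prodₚ (map Φ (P List.∷ʳ suc k))                  ≡⟨ cong ℚ[X].prodₚ (map-++ Φ P (suc k ∷ [])) ⟩
      ℚ[X].prodₚ (map Φ P List.++ Φ (suc k) ∷ [])           ≈⟨ ℚ[X].prodₚ-++ (map Φ P) (Φ (suc k) ∷ []) ⟩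
      ℚ[X].prodₚ (map Φ P) ℚ[X].*ₚ (Φ (suc k) ℚ[X].*ₚ ℚ[X].1ₚ) ≈⟨ ℚ[X].*ₚ-congʳ (ℚ[X].prodₚ (map Φ P)) (ℚ[X].*ₚ-identityʳ (Φ (suc k))) ⟩
      ℚ[X].prodₚ (map Φ P) ℚ[X].*ₚ Φ (suc k)                ≈⟨ ℚ[X].*ₚ-comm (ℚ[X].prodₚ (map Φ P)) (Φ (suc k)) ⟩
      Φ (suc k) ℚ[X].*ₚ ℚ[X].prodₚ (map Φ P)                ∎)
      where
      open ℚ[X].≈ₚ-Reasoning
      P = properDivisors (suc k)

    Φ-oddIntegral : ∀ n .{{_ : NonZero n}} → OddIntegral (Φ n)
    Φ-oddIntegral n@(suc _) = <-rec (λ n → NonZero n → OddIntegral (Φ n)) step n _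
      where
      step : ∀ n → (∀ {m} → m < n → NonZero m → OddIntegral (Φ m)) → NonZero n → OddIntegral (Φ n)
      step (suc k) IH _ = ↦ₚ-quotient (Φ (suc k)) A↦ A₀↦ ΦA-integral , Φ₀↦
        where
        A = ℚ[X].prodₚ (map Φ (properDivisors (suc k)))
        A-oddIntegral : OddIntegral A
        A-oddIntegral = prodₚ-oddIntegral Φ (All.tabulate λ d∈ →
          let (d≢0 , d<n , _) = ∈-properDivisors⁻ {n = suc k} d∈ in IH d<n d≢0)
        A↦ = proj₂ (proj₁ A-oddIntegral)
        A₀↦ = proj₂ A-oddIntegral
        ΦA↦ : Φ (suc k) ℚ[X].*ₚ A ↦ₚ X^ suc k +ₚ 1ₚ
        ΦA↦ = ↦ₚ-respˡ (ℚ[X].≈ₚ-sym (Φ*properFactors≈ k)) (xpow-1-↦ (suc k))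
        ΦA-integral : Integral (Φ (suc k) ℚ[X].*ₚ A)
        ΦA-integral n = _ , coeff-↦ ΦA↦ n
        Φ₀↦ : ℚ[X].coeff (Φ (suc k)) 0 ↦ true
        Φ₀↦ = ↦-cancelˡ A₀↦ (subst (_↦ true) (trans (ℚ[X].coeff₀-*ₚ (Φ (suc k)) A)
          (ℚ.*-comm (ℚ[X].coeff (Φ (suc k)) 0) (ℚ[X].coeff A 0))) (coeff-↦ ΦA↦ 0))

    ψ : ℕ → Poly₂
    ψ zero        = 𝔽₂[X].0ₚ  -- junk
    ψ n@(suc _)   = proj₁ (proj₁ (Φ-oddIntegral n))

    Φ↦ψ : ∀ n .{{_ : NonZero n}} → Φ n ↦ₚ ψ n
    Φ↦ψ n@(suc _) = proj₂ (proj₁ (Φ-oddIntegral n))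

    ψ-family : ∀ n .{{_ : NonZero n}} → X^ n +ₚ 1ₚ 𝔽₂[X].≈ₚ 𝔽₂[X].prodₚ (map ψ (divisors n))
    ψ-family n@(suc k) = ↦ₚ-unique (xpow-1-↦ n) (↦ₚ-respˡ (ℚ[X].≈ₚ-sym (Φ-family k))
      (↦ₚ-prodₚ Φ ψ (divisors n) (All.tabulate λ d∈ → Φ↦ψ _ {{proj₁ (∈-divisors⁻ {n = n} d∈)}})))

    ∣ₚ⇒∣ : ∀ {b u ū} .{{_ : NonZero b}} → Φ b ∣ₚ u → u ↦ₚ ū → ψ b ∣ ū
    ∣ₚ⇒∣ {b} {u} {ū} (q , Φq≈u) u↦ = q̄ , (begin
      q̄ *ₚ ψ b   ≈⟨ 𝔽₂[X].*ₚ-comm q̄ (ψ b) ⟩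
      ψ b *ₚ q̄   ≈⟨ ↦ₚ-unique (↦ₚ-* (Φ↦ψ b) q↦) Φq↦ū ⟩
      ū          ∎)
      where
      open 𝔽₂[X].≈ₚ-Reasoning
      Φq↦ū : Φ b ℚ[X].*ₚ q ↦ₚ ū
      Φq↦ū = ↦ₚ-respˡ (ℚ[X].≈ₚ-trans (ℚ[X].≈ₚ-sym (Defs-≈ₚ⇒≈ₚ Φq≈u)) (ℚ[X].≈ₚ-reflexive (Defs-*ₚ≡ (Φ b) q))) u↦
      q-reduces : ∃ (q ↦ₚ_)
      q-reduces = ↦ₚ-quotient q (Φ↦ψ b) (proj₂ (Φ-oddIntegral b))
        λ n → _ , coeff-↦ (↦ₚ-respˡ (ℚ[X].*ₚ-comm (Φ b) q) Φq↦ū) n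
      q̄ = proj₁ q-reduces
      q↦ = proj₂ q-reduces

module ReductionOfUW where
  open import Defs using (Poly; IsCyclotomicFamily; _∣ₚ_; U; W)
  open TwoIntegral using (↦-ι; _,_)
  open ReductionMod2
  open 𝔽₂[X] using (_≈ₚ_; _*ₚ_; X^_; sumₚ; geometric)
  open import Data.Integer.Base as ℤ using (+_)
  open import Data.Nat.Base as ℕ using (ℕ; _+_; _∸_; _≤_; NonZero; >-nonZero; s≤s; z≤n)
  import Data.Nat.Properties as ℕ
  open import Data.List.Base using (List; []; _∷_; map)
  open import Data.List.Properties using (map-∘)
  open import Data.List.Relation.Binary.Pointwise using ([]; _∷_)
  open import Data.Sum.Base using (_⊎_; [_,_]′)
  open import Function.Base using (_∘_)
  open import Relation.Binary.PropositionalEquality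

  UW₂ : ℕ → 𝔽₂[X].Poly
  UW₂ t = sumₚ (map X^_ (t + 3 ∷ t + 2 ∷ t + 1 ∷ t ∷ t ∸ 1 ∷ t ∸ 2 ∷ t ∸ 3 ∷ t ∸ 4 ∷ []))

  U-↦ : ∀ t → U t ↦ₚ UW₂ t
  U-↦ t = sumₚ-↦
    ( mono-↦-0ₚ (2 ℕ.* t ∸ 1) (↦-ι (+ 1 , refl))
    ∷ mono-↦-X^ (t + 3) (↦-ι (+ 0 , refl))
    ∷ mono-↦-X^ (t + 2) (↦-ι (ℤ.- + 1 , refl))
    ∷ mono-↦-X^ (t + 1) (↦-ι (+ 0 , refl))
    ∷ mono-↦-X^ t       (↦-ι (ℤ.- + 2 , refl))
    ∷ mono-↦-X^ (t ∸ 1) (↦-ι (+ 1 , refl))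
    ∷ mono-↦-X^ (t ∸ 2) (↦-ι (ℤ.- + 1 , refl))
    ∷ mono-↦-X^ (t ∸ 3) (↦-ι (+ 0 , refl))
    ∷ mono-↦-X^ (t ∸ 4) (↦-ι (ℤ.- + 1 , refl))
    ∷ mono-↦-0ₚ 0       (↦-ι (ℤ.- + 1 , refl))
    ∷ [])

  W-↦ : ∀ t → W t ↦ₚ UW₂ t
  W-↦ t = sumₚ-↦
    ( mono-↦-0ₚ (2 ℕ.* t ∸ 1) (↦-ι (+ 1 , refl))
    ∷ mono-↦-X^ (t + 3) (↦-ι (ℤ.- + 1 , refl))
    ∷ mono-↦-X^ (t + 2) (↦-ι (+ 0 , refl))
    ∷ mono-↦-X^ (t + 1) (↦-ι (ℤ.- + 1 , refl))
    ∷ mono-↦-X^ t       (↦-ι (ℤ.- + 1 , refl))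
    ∷ mono-↦-X^ (t ∸ 1) (↦-ι (+ 0 , refl))
    ∷ mono-↦-X^ (t ∸ 2) (↦-ι (+ 0 , refl))
    ∷ mono-↦-X^ (t ∸ 3) (↦-ι (ℤ.- + 1 , refl))
    ∷ mono-↦-X^ (t ∸ 4) (↦-ι (+ 0 , refl))
    ∷ mono-↦-0ₚ 0       (↦-ι (ℤ.- + 1 , refl))
    ∷ [])

  UW₂≈X^[t∸4]*geometric : ∀ t → 4 ≤ t → UW₂ t ≈ₚ X^ (t ∸ 4) *ₚ geometric 1 8
  UW₂≈X^[t∸4]*geometric t 4≤t = subst (λ s → UW₂ s ≈ₚ X^ (s ∸ 4) *ₚ geometric 1 8) (ℕ.m+[n∸m]≡n 4≤t) (begin
    UW₂ (4 + u)                              ≡⟨ cong (sumₚ ∘ map X^_) exponents ⟩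
    sumₚ (map X^_ (map (_+ u) ks))           ≡⟨ cong sumₚ (map-∘ {g = X^_} {f = _+ u} ks) ⟨
    sumₚ (map (λ k → X^ (k + u)) ks)         ≈⟨ 𝔽₂[X].sumₚ-cong X^[k+u]≈X^u*X^k ks ⟩
    sumₚ (map (λ k → X^ u *ₚ X^ k) ks)       ≡⟨ cong sumₚ (map-∘ {g = X^ u *ₚ_} {f = X^_} ks) ⟩
    sumₚ (map (X^ u *ₚ_) (map X^_ ks))       ≈⟨ 𝔽₂[X].*ₚ-sumₚ (X^ u) (map X^_ ks) ⟨
    X^ u *ₚ geometric 1 8                    ∎)
    where
    open 𝔽₂[X].≈ₚ-Reasoning
    u = t ∸ 4
    ks : List ℕ
    ks = 7 ∷ 6 ∷ 5 ∷ 4 ∷ 3 ∷ 2 ∷ 1 ∷ 0 ∷ []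
    exponents : 4 + u + 3 ∷ 4 + u + 2 ∷ 4 + u + 1 ∷ 4 + u ∷ 3 + u ∷ 2 + u ∷ 1 + u ∷ u ∷ [] ≡ map (_+ u) ks
    exponents = cong₂ _∷_ (cong-4+ (ℕ.+-comm u 3)) (cong₂ _∷_ (cong-4+ (ℕ.+-comm u 2)) (cong₂ _∷_ (cong-4+ (ℕ.+-comm u 1)) refl))
      where cong-4+ = cong (λ m → 4 + m)
    X^[k+u]≈X^u*X^k : ∀ k → X^ (k + u) ≈ₚ X^ u *ₚ X^ k
    X^[k+u]≈X^u*X^k k = 𝔽₂[X].≈ₚ-trans (𝔽₂[X].X^-+ k u) (𝔽₂[X].*ₚ-comm (X^ k) (X^ u))

  Φ[b]∣U⊎W⇒b≡4⊎b≡8 : ∀ Φ → IsCyclotomicFamily Φ → ∀ {t b} → 4 ≤ t → 3 ≤ b →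
    (Φ b ∣ₚ U t) ⊎ (Φ b ∣ₚ W t) → b ≡ 4 ⊎ b ≡ 8
  Φ[b]∣U⊎W⇒b≡4⊎b≡8 Φ Φ-cyclotomic {t} {b} 4≤t 3≤b Φ∣U⊎Φ∣W =
    𝔽₂[X].CyclotomicFamily.ψ∣X^u*geometric⇒4⊎8 ψ ψ-family (t ∸ 4) 3≤b
      (𝔽₂[X].∣ʳ-respʳ-≈ (UW₂≈X^[t∸4]*geometric t 4≤t) ψ∣UW₂)
    where
    open CyclotomicReduction Φ Φ-cyclotomic
    instance
      b≢0 : NonZero b
      b≢0 = >-nonZero (ℕ.<-≤-trans (s≤s z≤n) 3≤b)
    ψ∣UW₂ : ψ b 𝔽₂[X].∣ UW₂ t
    ψ∣UW₂ = [ (λ Φ∣U → ∣ₚ⇒∣ Φ∣U (U-↦ t)) , (λ Φ∣W → ∣ₚ⇒∣ Φ∣W (W-↦ t)) ]′ Φ∣U⊎Φ∣W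

open ReductionOfUW using (Φ[b]∣U⊎W⇒b≡4⊎b≡8)

open import Defs
open import Data.Nat using (ℕ; _≤_; _*_; _^_)
open import Data.Nat.Divisibility using (_∣_; ∣⇒≤)
open import Data.Nat.Primality using (Prime)
open import Data.Sum using (_⊎_; inj₁; inj₂)
open import Data.Product using (_×_; _,_)
open import Relation.Nullary using (¬_)
open import Relation.Binary.PropositionalEquality using (_≡_; refl)
import Data.Nat.Properties as ℕ

m∣4⊎8⇒m≤8 : ∀ {b m} → b ≡ 4 ⊎ b ≡ 8 → m ∣ b → m ≤ 8
m∣4⊎8⇒m≤8 (inj₁ refl) m∣4 = ℕ.≤-trans (∣⇒≤ m∣4) (ℕ.m≤m+n 4 4)
m∣4⊎8⇒m≤8 (inj₂ refl) m∣8 = ∣⇒≤ m∣8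

lemma5p4 : (Φ : ℕ → Poly) → IsCyclotomicFamily Φ →
    (t : ℕ) → 2 ∣ t → 4 ≤ t → (b : ℕ) → 3 ≤ b →
    (Φ b ∣ₚ U t) ⊎ (Φ b ∣ₚ W t) →
    ((p : ℕ) → Prime p → 7 ≤ p → ¬ (p * p ∣ b))
    × ¬ (5 ^ 3 ∣ b) × ¬ (3 ^ 3 ∣ b)
    × (4 ∣ b → (b ≡ 4) ⊎ (b ≡ 8))
lemma5p4 Φ Φ-cyclotomic t _ 4≤t b 3≤b Φ∣U⊎Φ∣W =
    (λ p _ 7≤p → too-large (ℕ.≤-trans (ℕ.m≤m+n 9 40) (ℕ.*-mono-≤ 7≤p 7≤p)))
  , too-large (ℕ.m≤m+n 9 116)
  , too-large (ℕ.m≤m+n 9 18)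
  , λ _ → b≡4⊎b≡8
  where
  b≡4⊎b≡8 : b ≡ 4 ⊎ b ≡ 8
  b≡4⊎b≡8 = Φ[b]∣U⊎W⇒b≡4⊎b≡8 Φ Φ-cyclotomic 4≤t 3≤b Φ∣U⊎Φ∣W
  too-large : ∀ {m} → 9 ≤ m → ¬ (m ∣ b)
  too-large 9≤m m∣b = ℕ.<⇒≱ 9≤m (m∣4⊎8⇒m≤8 b≡4⊎b≡8 m∣b)
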